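{- Let $n$ be a positive integer and let $a,s$ be non-negative integers with $a\leqslant n$. Then $$ \sum_{k=a}^{n}q^{n-k}[2k+1] {2n+1\brack n-k}(q^{ -k};q)_s (q^{k+1};q)_s \equiv 0\pmod{[2n+1]{2n\brack n-a}}. $$
   Context: $q$ is an indeterminate, $[n]=\frac{1-q^n}{1-q}$, $(x;q)_0=1$ and $(x;q)_s=(1-x)(1-xq)\cdots(1-xq^{s-1})$, and ${n\brack k}=\frac{(q;q)_n}{(q;q)_k(q;q)_{n-k}}$ for $0\leqslant k\leqslant n$, $0$ otherwise. For a Laurent polynomial $P(q)$ and a polynomial $D(q)$, $P(q)\equiv 0\pmod{D(q)}$ means that $P(q)/D(q)$ is a Laurent polynomial in $q$. -}

module Defs where

open import Data.Nat as ℕ using (ℕ; zero; suc)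
open import Data.Integer as ℤ using (ℤ; +_; -[1+_]; 0ℤ; 1ℤ)
open import Data.List using (List; []; _∷_; map; replicate; _++_; foldr; upTo)
open import Data.Product using (Σ)
open import Relation.Binary.PropositionalEquality using (_≡_)

-- Polynomials in q with integer coefficients: coefficient lists,
-- lowest degree first (trailing zeros allowed).

Poly : Set
Poly = List ℤ

_⊕_ : Poly → Poly → Poly
[] ⊕ ys = ys
(x ∷ xs) ⊕ [] = x ∷ xs
(x ∷ xs) ⊕ (y ∷ ys) = (x ℤ.+ y) ∷ (xs ⊕ ys)

_⊗_ : Poly → Poly → Poly
[] ⊗ ys = []
(x ∷ xs) ⊗ ys = map (x ℤ.*_) ys ⊕ (0ℤ ∷ (xs ⊗ ys))

shiftP : ℕ → Poly → Poly
shiftP m p = replicate m 0ℤ ++ p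

-- Laurent polynomials: q^(-sh) * cs(q)

record Laurent : Set where
  constructor laurent
  field
    sh : ℕ
    cs : Poly
open Laurent public

lookupZ : Poly → ℕ → ℤ
lookupZ [] _ = 0ℤ
lookupZ (x ∷ xs) zero = x
lookupZ (x ∷ xs) (suc i) = lookupZ xs i

coeff : Laurent → ℤ → ℤ
coeff (laurent a p) d with d ℤ.+ (+ a)
... | + m = lookupZ p m
... | -[1+ _ ] = 0ℤ

_≈_ : Laurent → Laurent → Set
P ≈ Q = ∀ d → coeff P d ≡ coeff Q d

infixl 6 _+L_ _-L_
infixl 7 _*L_

_+L_ : Laurent → Laurent → Laurent
laurent a p +L laurent b r = laurent (a ℕ.+ b) (shiftP b p ⊕ shiftP a r)

_*L_ : Laurent → Laurent → Laurent
laurent a p *L laurent b r = laurent (a ℕ.+ b) (p ⊗ r)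

negL : Laurent → Laurent
negL (laurent a p) = laurent a (map ℤ.-_ p)

_-L_ : Laurent → Laurent → Laurent
P -L Q = P +L negL Q

zeroL oneL : Laurent
zeroL = laurent 0 []
oneL = laurent 0 (1ℤ ∷ [])

qpow : ℤ → Laurent
qpow (+ m) = laurent 0 (replicate m 0ℤ ++ (1ℤ ∷ []))
qpow -[1+ m ] = laurent (suc m) (1ℤ ∷ [])

qpowℕ : ℕ → Laurent
qpowℕ m = qpow (+ m)

sumL : List Laurent → Laurent
sumL = foldr _+L_ zeroL

prodL : List Laurent → Laurent
prodL = foldr _*L_ oneL

qint : ℕ → Laurent
qint n = sumL (map qpowℕ (upTo n))

qPoch : ℤ → ℕ → Laurent
qPoch c s = prodL (map (λ i → oneL -L qpow (c ℤ.+ (+ i))) (upTo s))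

-- Gaussian binomial coefficient [n choose k] via the q-Pascal rule
--   [n+1, k+1] = [n, k] + q^(k+1) [n, k+1],  [n,0] = 1,  [0,k+1] = 0
-- (equals (q;q)_n / ((q;q)_k (q;q)_{n-k}) for k ≤ n, and 0 for k > n)
qbinom : ℕ → ℕ → Laurent
qbinom n zero = oneL
qbinom zero (suc k) = zeroL
qbinom (suc n) (suc k) = qbinom n k +L qpowℕ (suc k) *L qbinom n (suc k)

_∣L_ : Laurent → Laurent → Set
D ∣L P = Σ Laurent (λ R → P ≈ (D *L R))

term : ℕ → ℕ → ℕ → Laurent
term n s k =
  qpowℕ (n ℕ.∸ k) *L qint (2 ℕ.* k ℕ.+ 1) *L qbinom (2 ℕ.* n ℕ.+ 1) (n ℕ.∸ k)
    *L qPoch (ℤ.- (+ k)) s *L qPoch (+ (k ℕ.+ 1)) s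

lhs : ℕ → ℕ → ℕ → Laurent
lhs n a s = sumL (map (λ j → term n s (a ℕ.+ j)) (upTo (suc (n ℕ.∸ a))))

modulus : ℕ → ℕ → Laurent
modulus n a = qint (2 ℕ.* n ℕ.+ 1) *L qbinom (2 ℕ.* n) (n ℕ.∸ a)

module Submission where

open import Defs
open import Data.Nat using (ℕ; _≤_)

-- Induction on s, for all n and a at once, with A_n(x) = (1 - q^{n-x}) (1 - q^{n+x+1}):
--  * s = 0: the sum telescopes to L(n,a,0) = M(n,a).
--  * s → s+1: the new factors of T(n,s+1,k) are q^{s-n} (A_n(k) - A_n(s)), so
--      L(n,a,s+1) = q^{s-n} (Σ_k T(n,s,k) A_n(k) - A_n(s) L(n,a,s)).
--    The k = n summand of the first sum vanishes and T(n,s,k) A_n(k) = C_n T(n-1,s,k)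
--    for k < n, with C_n = q (1 - q^{2n+1}) (1 - q^{2n}); as C_n M(n-1,a) is a
--    multiple of M(n,a), both sums are divisible by induction.

module CoefficientLists where

  open import Data.Nat as ℕ using (zero; suc)
  open import Data.Integer as ℤ using (ℤ; 0ℤ; 1ℤ)
  import Data.Integer.Properties as ℤP
  open import Data.List using ([]; _∷_; map)
  open import Relation.Binary.PropositionalEquality

  -- Equality of polynomials: all coefficients agree (trailing zeros are invisible).
  infix 4 _≋_
  record _≋_ (p r : Poly) : Set where
    constructor mk≋
    field at : ∀ i → lookupZ p i ≡ lookupZ r i
  open _≋_ public

  ≋-refl : ∀ {p} → p ≋ p
  ≋-refl = mk≋ λ i → refl

  ≋-sym : ∀ {p r} → p ≋ r → r ≋ p
  ≋-sym e = mk≋ λ i → sym (at e i)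

  ≋-trans : ∀ {p r t} → p ≋ r → r ≋ t → p ≋ t
  ≋-trans e f = mk≋ λ i → trans (at e i) (at f i)

  ∷-cong : ∀ {x y p r} → x ≡ y → p ≋ r → (x ∷ p) ≋ (y ∷ r)
  ∷-cong e f = mk≋ λ { zero → e ; (suc i) → at f i }

  ∷-tail : ∀ {x y p r} → (x ∷ p) ≋ (y ∷ r) → p ≋ r
  ∷-tail e = mk≋ λ i → at e (suc i)

  scale : ℤ → Poly → Poly
  scale c = map (c ℤ.*_)

  lookup-⊕ : ∀ p r i → lookupZ (p ⊕ r) i ≡ lookupZ p i ℤ.+ lookupZ r i
  lookup-⊕ [] r i = sym (ℤP.+-identityˡ _)
  lookup-⊕ (x ∷ p) [] zero = sym (ℤP.+-identityʳ _)
  lookup-⊕ (x ∷ p) [] (suc i) = sym (ℤP.+-identityʳ _)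
  lookup-⊕ (x ∷ p) (y ∷ r) zero = refl
  lookup-⊕ (x ∷ p) (y ∷ r) (suc i) = lookup-⊕ p r i

  lookup-scale : ∀ c p i → lookupZ (scale c p) i ≡ c ℤ.* lookupZ p i
  lookup-scale c [] i = sym (ℤP.*-zeroʳ c)
  lookup-scale c (x ∷ p) zero = refl
  lookup-scale c (x ∷ p) (suc i) = lookup-scale c p i

  lookup-neg : ∀ p i → lookupZ (map ℤ.-_ p) i ≡ ℤ.- lookupZ p i
  lookup-neg [] i = refl
  lookup-neg (x ∷ p) zero = refl
  lookup-neg (x ∷ p) (suc i) = lookup-neg p i

  lookup-∷⊗ : ∀ x p r i → lookupZ ((x ∷ p) ⊗ r) i ≡ x ℤ.* lookupZ r i ℤ.+ lookupZ (0ℤ ∷ (p ⊗ r)) i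
  lookup-∷⊗ x p r i = trans (lookup-⊕ (scale x r) (0ℤ ∷ (p ⊗ r)) i) (cong (ℤ._+ lookupZ (0ℤ ∷ (p ⊗ r)) i) (lookup-scale x r i))

  ⊕-cong : ∀ {p p' r r'} → p ≋ p' → r ≋ r' → (p ⊕ r) ≋ (p' ⊕ r')
  ⊕-cong {p} {p'} {r} {r'} e f = mk≋ λ i →
    trans (lookup-⊕ p r i) (trans (cong₂ ℤ._+_ (at e i) (at f i)) (sym (lookup-⊕ p' r' i)))

  ⊕-comm : ∀ p r → (p ⊕ r) ≋ (r ⊕ p)
  ⊕-comm p r = mk≋ λ i →
    trans (lookup-⊕ p r i) (trans (ℤP.+-comm (lookupZ p i) (lookupZ r i)) (sym (lookup-⊕ r p i)))

  ⊕-assoc : ∀ p r t → ((p ⊕ r) ⊕ t) ≋ (p ⊕ (r ⊕ t))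
  ⊕-assoc p r t = mk≋ λ i → begin
    lookupZ ((p ⊕ r) ⊕ t) i                       ≡⟨ lookup-⊕ (p ⊕ r) t i ⟩
    lookupZ (p ⊕ r) i ℤ.+ lookupZ t i               ≡⟨ cong (ℤ._+ lookupZ t i) (lookup-⊕ p r i) ⟩
    lookupZ p i ℤ.+ lookupZ r i ℤ.+ lookupZ t i     ≡⟨ ℤP.+-assoc (lookupZ p i) (lookupZ r i) (lookupZ t i) ⟩
    lookupZ p i ℤ.+ (lookupZ r i ℤ.+ lookupZ t i)   ≡⟨ cong (ℤ._+_ (lookupZ p i)) (sym (lookup-⊕ r t i)) ⟩
    lookupZ p i ℤ.+ lookupZ (r ⊕ t) i               ≡⟨ sym (lookup-⊕ p (r ⊕ t) i) ⟩
    lookupZ (p ⊕ (r ⊕ t)) i                       ∎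
    where open ≡-Reasoning

  ⊕-identityʳ : ∀ p → (p ⊕ []) ≋ p
  ⊕-identityʳ [] = ≋-refl
  ⊕-identityʳ (x ∷ p) = ≋-refl

  ⊕-interchange : ∀ a b c d → ((a ⊕ b) ⊕ (c ⊕ d)) ≋ ((a ⊕ c) ⊕ (b ⊕ d))
  ⊕-interchange a b c d =
    ≋-trans (⊕-assoc a b (c ⊕ d))
      (≋-trans (⊕-cong (≋-refl {a}) (≋-trans (≋-sym (⊕-assoc b c d))
                 (≋-trans (⊕-cong (⊕-comm b c) (≋-refl {d})) (⊕-assoc c b d))))
      (≋-sym (⊕-assoc a c (b ⊕ d))))

  scale-⊕ : ∀ c p r → scale c (p ⊕ r) ≋ (scale c p ⊕ scale c r)
  scale-⊕ c p r = mk≋ λ i →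
    trans (lookup-scale c (p ⊕ r) i) (trans (cong (c ℤ.*_) (lookup-⊕ p r i))
      (trans (ℤP.*-distribˡ-+ c _ _)
        (sym (trans (lookup-⊕ (scale c p) (scale c r) i) (cong₂ ℤ._+_ (lookup-scale c p i) (lookup-scale c r i))))))

  scale-+ : ∀ x y r → scale (x ℤ.+ y) r ≋ (scale x r ⊕ scale y r)
  scale-+ x y r = mk≋ λ i →
    trans (lookup-scale (x ℤ.+ y) r i) (trans (ℤP.*-distribʳ-+ _ x y)
      (sym (trans (lookup-⊕ (scale x r) (scale y r) i) (cong₂ ℤ._+_ (lookup-scale x r i) (lookup-scale y r i)))))

  scale-scale : ∀ x y r → scale x (scale y r) ≋ scale (x ℤ.* y) r
  scale-scale x y r = mk≋ λ i →
    trans (lookup-scale x (scale y r) i) (trans (cong (x ℤ.*_) (lookup-scale y r i))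
      (trans (sym (ℤP.*-assoc x y _)) (sym (lookup-scale (x ℤ.* y) r i))))

  ⊗-zeroˡ : ∀ p r → [] ≋ p → (p ⊗ r) ≋ []
  ⊗-zeroˡ [] r e = ≋-refl
  ⊗-zeroˡ (x ∷ p) r e = mk≋ λ i → trans (lookup-∷⊗ x p r i) (cong₂ ℤ._+_ (head-zero i) (tail-zero i))
    where
    head-zero : ∀ i → x ℤ.* lookupZ r i ≡ 0ℤ
    head-zero i = trans (cong (ℤ._* lookupZ r i) (sym (at e zero))) (ℤP.*-zeroˡ (lookupZ r i))
    tail-zero : ∀ i → lookupZ (0ℤ ∷ (p ⊗ r)) i ≡ 0ℤ
    tail-zero zero = refl
    tail-zero (suc i) = at (⊗-zeroˡ p r (mk≋ λ j → at e (suc j))) i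

  ⊗-congˡ : ∀ {p p'} r → p ≋ p' → (p ⊗ r) ≋ (p' ⊗ r)
  ⊗-congˡ {[]} {p'} r e = ≋-sym (⊗-zeroˡ p' r e)
  ⊗-congˡ {x ∷ p} {[]} r e = ⊗-zeroˡ (x ∷ p) r (≋-sym e)
  ⊗-congˡ {x ∷ p} {x' ∷ p'} r e =
    ⊕-cong (mk≋ λ i → cong (λ c → lookupZ (scale c r) i) (at e zero)) (∷-cong refl (⊗-congˡ r (∷-tail e)))

  ⊗-distribʳ : ∀ p p' r → ((p ⊕ p') ⊗ r) ≋ ((p ⊗ r) ⊕ (p' ⊗ r))
  ⊗-distribʳ [] p' r = ≋-refl
  ⊗-distribʳ (x ∷ p) [] r = ≋-sym (⊕-identityʳ _)
  ⊗-distribʳ (x ∷ p) (y ∷ p') r =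
    ≋-trans (⊕-cong (scale-+ x y r) (∷-cong refl (⊗-distribʳ p p' r)))
      (⊕-interchange (scale x r) (scale y r) (0ℤ ∷ (p ⊗ r)) (0ℤ ∷ (p' ⊗ r)))

  0∷-⊗ : ∀ p r → ((0ℤ ∷ p) ⊗ r) ≋ (0ℤ ∷ (p ⊗ r))
  0∷-⊗ p r = mk≋ λ i →
    trans (lookup-∷⊗ 0ℤ p r i) (trans (cong (ℤ._+ lookupZ (0ℤ ∷ (p ⊗ r)) i) (ℤP.*-zeroˡ (lookupZ r i))) (ℤP.+-identityˡ _))

  scale-⊗ : ∀ x r t → (scale x r ⊗ t) ≋ scale x (r ⊗ t)
  scale-⊗ x [] t = ≋-refl
  scale-⊗ x (y ∷ r) t =
    ≋-trans (⊕-cong (≋-refl {scale (x ℤ.* y) t}) (∷-cong refl (scale-⊗ x r t)))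
      (≋-trans (⊕-cong (≋-sym (scale-scale x y t)) (∷-cong (sym (ℤP.*-zeroʳ x)) ≋-refl))
        (≋-sym (scale-⊕ x (scale y t) (0ℤ ∷ (r ⊗ t)))))

  ⊗-assoc : ∀ p r t → ((p ⊗ r) ⊗ t) ≋ (p ⊗ (r ⊗ t))
  ⊗-assoc [] r t = ≋-refl
  ⊗-assoc (x ∷ p) r t =
    ≋-trans (⊗-distribʳ (scale x r) (0ℤ ∷ (p ⊗ r)) t)
      (⊕-cong (scale-⊗ x r t) (≋-trans (0∷-⊗ (p ⊗ r) t) (∷-cong refl (⊗-assoc p r t))))

  ⊗-zeroʳ : ∀ p → (p ⊗ []) ≋ []
  ⊗-zeroʳ [] = ≋-refl
  ⊗-zeroʳ (x ∷ p) = mk≋ λ { zero → refl ; (suc i) → at (⊗-zeroʳ p) i }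

  ⊗-∷ : ∀ p y ys → (p ⊗ (y ∷ ys)) ≋ (scale y p ⊕ (0ℤ ∷ (p ⊗ ys)))
  ⊗-∷ [] y ys = mk≋ λ { zero → refl ; (suc i) → refl }
  ⊗-∷ (x ∷ p) y ys = mk≋ λ
    { zero → trans (ℤP.+-identityʳ _) (trans (ℤP.*-comm x y) (sym (ℤP.+-identityʳ _)))
    ; (suc i) → higher i }
    where
    higher : ∀ i → lookupZ (scale x ys ⊕ (p ⊗ (y ∷ ys))) i ≡ lookupZ (scale y p ⊕ ((x ∷ p) ⊗ ys)) i
    higher i = begin
      lookupZ (scale x ys ⊕ (p ⊗ (y ∷ ys))) i        ≡⟨ lookup-⊕ (scale x ys) (p ⊗ (y ∷ ys)) i ⟩
      a ℤ.+ lookupZ (p ⊗ (y ∷ ys)) i                ≡⟨ cong (ℤ._+_ a) (trans (at (⊗-∷ p y ys) i) (lookup-⊕ (scale y p) _ i)) ⟩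
      a ℤ.+ (b ℤ.+ c)                               ≡⟨ sym (ℤP.+-assoc a b c) ⟩
      a ℤ.+ b ℤ.+ c                                 ≡⟨ cong (ℤ._+ c) (ℤP.+-comm a b) ⟩
      b ℤ.+ a ℤ.+ c                                 ≡⟨ ℤP.+-assoc b a c ⟩
      b ℤ.+ (a ℤ.+ c)                               ≡⟨ cong (ℤ._+_ b) (sym (lookup-⊕ (scale x ys) (0ℤ ∷ (p ⊗ ys)) i)) ⟩
      b ℤ.+ lookupZ ((x ∷ p) ⊗ ys) i                ≡⟨ sym (lookup-⊕ (scale y p) ((x ∷ p) ⊗ ys) i) ⟩
      lookupZ (scale y p ⊕ ((x ∷ p) ⊗ ys)) i        ∎
      where
      open ≡-Reasoning
      a = lookupZ (scale x ys) i
      b = lookupZ (scale y p) i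
      c = lookupZ (0ℤ ∷ (p ⊗ ys)) i

  ⊗-comm : ∀ p r → (p ⊗ r) ≋ (r ⊗ p)
  ⊗-comm [] r = ≋-sym (⊗-zeroʳ r)
  ⊗-comm (x ∷ p) r = ≋-trans (⊕-cong (≋-refl {scale x r}) (∷-cong refl (⊗-comm p r))) (≋-sym (⊗-∷ r x p))

  ⊗-identityˡ : ∀ p → ((1ℤ ∷ []) ⊗ p) ≋ p
  ⊗-identityˡ p = mk≋ λ i →
    trans (lookup-⊕ (scale 1ℤ p) (0ℤ ∷ []) i)
      (trans (cong₂ ℤ._+_ (trans (lookup-scale 1ℤ p i) (ℤP.*-identityˡ _)) (zero-tail i)) (ℤP.+-identityʳ _))
    where
    zero-tail : ∀ i → lookupZ (0ℤ ∷ []) i ≡ 0ℤ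
    zero-tail zero = refl
    zero-tail (suc i) = refl

  shift-⊗ : ∀ m p r → (shiftP m p ⊗ r) ≋ shiftP m (p ⊗ r)
  shift-⊗ zero p r = ≋-refl
  shift-⊗ (suc m) p r = ≋-trans (0∷-⊗ (shiftP m p) r) (∷-cong refl (shift-⊗ m p r))

  shift-cong : ∀ m {p r} → p ≋ r → shiftP m p ≋ shiftP m r
  shift-cong zero e = e
  shift-cong (suc m) e = ∷-cong refl (shift-cong m e)

  shift-shift : ∀ m k p → shiftP m (shiftP k p) ≡ shiftP (m ℕ.+ k) p
  shift-shift zero k p = refl
  shift-shift (suc m) k p = cong (0ℤ ∷_) (shift-shift m k p)

module LaurentPolynomials where

  open CoefficientLists
  open import Data.Nat as ℕ using (ℕ; zero; suc)
  import Data.Nat.Properties as ℕP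
  open import Data.Integer as ℤ using (ℤ; +_; -[1+_]; 0ℤ; 1ℤ)
  import Data.Integer.Properties as ℤP
  open import Data.List using ([]; _∷_; map)
  open import Relation.Binary.PropositionalEquality
  open import Data.Nat.Tactic.RingSolver using (solve-∀)

  coeffP : ℤ → Poly → ℤ
  coeffP (+ m) p = lookupZ p m
  coeffP -[1+ _ ] p = 0ℤ

  coeff-laurent : ∀ a p d → coeff (laurent a p) d ≡ coeffP (d ℤ.+ + a) p
  coeff-laurent a p d with d ℤ.+ (+ a)
  ... | + m = refl
  ... | -[1+ _ ] = refl

  coeffP-0∷ : ∀ w p → coeffP (ℤ.suc w) (0ℤ ∷ p) ≡ coeffP w p
  coeffP-0∷ (+ m) p = refl
  coeffP-0∷ -[1+ zero ] p = refl
  coeffP-0∷ -[1+ suc k ] p = refl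

  coeffP-shift : ∀ w b p → coeffP (w ℤ.+ + b) (shiftP b p) ≡ coeffP w p
  coeffP-shift w zero p = cong (λ v → coeffP v p) (ℤP.+-identityʳ w)
  coeffP-shift w (suc b) p =
    trans (cong (λ v → coeffP v (shiftP (suc b) p)) (suc-outside w b))
      (trans (coeffP-0∷ (w ℤ.+ + b) (shiftP b p)) (coeffP-shift w b p))
    where
    suc-outside : ∀ w b → w ℤ.+ + suc b ≡ ℤ.suc (w ℤ.+ + b)
    suc-outside w b = trans (sym (ℤP.+-assoc w 1ℤ (+ b)))
      (trans (cong (ℤ._+ + b) (ℤP.+-comm w 1ℤ)) (ℤP.+-assoc 1ℤ w (+ b)))

  coeffP-⊕ : ∀ w p r → coeffP w (p ⊕ r) ≡ coeffP w p ℤ.+ coeffP w r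
  coeffP-⊕ (+ m) p r = lookup-⊕ p r m
  coeffP-⊕ -[1+ _ ] p r = refl

  coeffP-cong : ∀ w {p r} → p ≋ r → coeffP w p ≡ coeffP w r
  coeffP-cong (+ m) e = at e m
  coeffP-cong -[1+ _ ] e = refl

  ≈-refl : ∀ {X} → X ≈ X
  ≈-refl d = refl

  ≈-sym : ∀ {X Y} → X ≈ Y → Y ≈ X
  ≈-sym e d = sym (e d)

  ≈-trans : ∀ {X Y Z} → X ≈ Y → Y ≈ Z → X ≈ Z
  ≈-trans e f d = trans (e d) (f d)

  -- q^{-(a+b)} (q^b p) = q^{-a} p: the representation is not unique.
  laurent-shift : ∀ {N} a b p → a ℕ.+ b ≡ N → laurent N (shiftP b p) ≈ laurent a p
  laurent-shift a b p refl d =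
    trans (coeff-laurent (a ℕ.+ b) (shiftP b p) d)
      (trans (cong (λ w → coeffP w (shiftP b p)) (sym (ℤP.+-assoc d (+ a) (+ b))))
        (trans (coeffP-shift (d ℤ.+ + a) b p) (sym (coeff-laurent a p d))))

  laurent-cong : ∀ c {p r} → p ≋ r → laurent c p ≈ laurent c r
  laurent-cong c {p} {r} e d =
    trans (coeff-laurent c p d) (trans (coeffP-cong (d ℤ.+ + c) e) (sym (coeff-laurent c r d)))

  laurent-cong⁻¹ : ∀ c {p r} → laurent c p ≈ laurent c r → p ≋ r
  laurent-cong⁻¹ c {p} {r} e = mk≋ λ i →
    trans (sym (at-index p i)) (trans (sym (coeff-laurent c p (+ i ℤ.- + c)))
      (trans (e (+ i ℤ.- + c)) (trans (coeff-laurent c r (+ i ℤ.- + c)) (at-index r i))))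
    where
    at-index : ∀ t i → coeffP ((+ i ℤ.- + c) ℤ.+ + c) t ≡ lookupZ t i
    at-index t i = cong (λ w → coeffP w t)
      (trans (ℤP.+-assoc (+ i) (ℤ.- + c) (+ c)) (trans (cong (ℤ._+_ (+ i)) (ℤP.+-inverseˡ (+ c))) (ℤP.+-identityʳ (+ i))))

  coeff-+ : ∀ X Y d → coeff (X +L Y) d ≡ coeff X d ℤ.+ coeff Y d
  coeff-+ (laurent a p) (laurent b r) d =
    trans (coeff-laurent (a ℕ.+ b) (shiftP b p ⊕ shiftP a r) d)
      (trans (coeffP-⊕ (d ℤ.+ + (a ℕ.+ b)) (shiftP b p) (shiftP a r))
        (cong₂ ℤ._+_ (trans (sym (coeff-laurent (a ℕ.+ b) (shiftP b p) d)) (laurent-shift a b p refl d))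
                     (trans (sym (coeff-laurent (a ℕ.+ b) (shiftP a r) d)) (laurent-shift b a r (ℕP.+-comm b a) d))))

  coeff-neg : ∀ X d → coeff (negL X) d ≡ ℤ.- coeff X d
  coeff-neg (laurent a p) d =
    trans (coeff-laurent a (map ℤ.-_ p) d) (trans (neg-at (d ℤ.+ + a)) (cong ℤ.-_ (sym (coeff-laurent a p d))))
    where
    neg-at : ∀ w → coeffP w (map ℤ.-_ p) ≡ ℤ.- coeffP w p
    neg-at (+ m) = lookup-neg p m
    neg-at -[1+ _ ] = refl

  κ : ℤ → Laurent
  κ c = laurent 0 (c ∷ [])

  coeff-κ0 : ∀ d → coeff (κ 0ℤ) d ≡ 0ℤ
  coeff-κ0 d = trans (coeff-laurent 0 (0ℤ ∷ []) d) (zero-at (d ℤ.+ + 0))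
    where
    zero-at : ∀ w → coeffP w (0ℤ ∷ []) ≡ 0ℤ
    zero-at (+ zero) = refl
    zero-at (+ suc m) = refl
    zero-at -[1+ _ ] = refl

  zeroL≈κ0 : zeroL ≈ κ 0ℤ
  zeroL≈κ0 d = trans (coeff-laurent 0 [] d) (trans (zero-at (d ℤ.+ + 0)) (sym (coeff-κ0 d)))
    where
    zero-at : ∀ w → coeffP w [] ≡ 0ℤ
    zero-at (+ m) = refl
    zero-at -[1+ _ ] = refl

  +L-cong : ∀ {X X' Y Y'} → X ≈ X' → Y ≈ Y' → (X +L Y) ≈ (X' +L Y')
  +L-cong {X} {X'} {Y} {Y'} e f d = trans (coeff-+ X Y d) (trans (cong₂ ℤ._+_ (e d) (f d)) (sym (coeff-+ X' Y' d)))

  +L-comm : ∀ X Y → (X +L Y) ≈ (Y +L X)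
  +L-comm X Y d = trans (coeff-+ X Y d) (trans (ℤP.+-comm (coeff X d) (coeff Y d)) (sym (coeff-+ Y X d)))

  +L-assoc : ∀ X Y Z → ((X +L Y) +L Z) ≈ (X +L (Y +L Z))
  +L-assoc X Y Z d =
    trans (coeff-+ (X +L Y) Z d) (trans (cong (ℤ._+ coeff Z d) (coeff-+ X Y d))
      (trans (ℤP.+-assoc (coeff X d) (coeff Y d) (coeff Z d))
        (sym (trans (coeff-+ X (Y +L Z) d) (cong (ℤ._+_ (coeff X d)) (coeff-+ Y Z d))))))

  +L-identityˡ : ∀ X → (κ 0ℤ +L X) ≈ X
  +L-identityˡ X d = trans (coeff-+ (κ 0ℤ) X d) (trans (cong (ℤ._+ coeff X d) (coeff-κ0 d)) (ℤP.+-identityˡ _))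

  +L-identityʳ : ∀ X → (X +L κ 0ℤ) ≈ X
  +L-identityʳ X = ≈-trans (+L-comm X (κ 0ℤ)) (+L-identityˡ X)

  negL-inverseˡ : ∀ X → (negL X +L X) ≈ κ 0ℤ
  negL-inverseˡ X d =
    trans (coeff-+ (negL X) X d) (trans (cong (ℤ._+ coeff X d) (coeff-neg X d))
      (trans (ℤP.+-inverseˡ (coeff X d)) (sym (coeff-κ0 d))))

  negL-inverseʳ : ∀ X → (X +L negL X) ≈ κ 0ℤ
  negL-inverseʳ X = ≈-trans (+L-comm X (negL X)) (negL-inverseˡ X)

  negL-cong : ∀ {X Y} → X ≈ Y → negL X ≈ negL Y
  negL-cong {X} {Y} e d = trans (coeff-neg X d) (trans (cong ℤ.-_ (e d)) (sym (coeff-neg Y d)))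

  *L-comm : ∀ X Y → (X *L Y) ≈ (Y *L X)
  *L-comm (laurent a p) (laurent b r) rewrite ℕP.+-comm a b = laurent-cong (b ℕ.+ a) (⊗-comm p r)

  *L-assoc : ∀ X Y Z → ((X *L Y) *L Z) ≈ (X *L (Y *L Z))
  *L-assoc (laurent a p) (laurent b r) (laurent c t) rewrite ℕP.+-assoc a b c =
    laurent-cong (a ℕ.+ (b ℕ.+ c)) (⊗-assoc p r t)

  *L-identityˡ : ∀ X → (oneL *L X) ≈ X
  *L-identityˡ (laurent a p) = laurent-cong a (⊗-identityˡ p)

  *L-identityʳ : ∀ X → (X *L oneL) ≈ X
  *L-identityʳ X = ≈-trans (*L-comm X oneL) (*L-identityˡ X)

  -- Both sides are brought to the common denominator q^{a+b+a'}.
  *L-congˡ : ∀ {X X'} Y → X ≈ X' → (X *L Y) ≈ (X' *L Y)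
  *L-congˡ {laurent a p} {laurent a' p'} (laurent b r) e =
    ≈-trans (≈-sym (laurent-shift (a ℕ.+ b) a' (p ⊗ r) refl))
      (≈-trans (laurent-cong N (≋-sym (shift-⊗ a' p r)))
        (≈-trans (laurent-cong N (⊗-congˡ r same-numerator))
          (≈-trans (laurent-cong N (shift-⊗ a p' r))
            (laurent-shift (a' ℕ.+ b) a (p' ⊗ r) (swap a' b a)))))
    where
    N = (a ℕ.+ b) ℕ.+ a'
    swap : ∀ x y z → (x ℕ.+ y) ℕ.+ z ≡ (z ℕ.+ y) ℕ.+ x
    swap = solve-∀
    same-numerator : shiftP a' p ≋ shiftP a p'
    same-numerator = laurent-cong⁻¹ (a ℕ.+ a')
      (≈-trans (laurent-shift a a' p refl) (≈-trans e (≈-sym (laurent-shift a' a p' (ℕP.+-comm a' a)))))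

  *L-cong : ∀ {X X' Y Y'} → X ≈ X' → Y ≈ Y' → (X *L Y) ≈ (X' *L Y')
  *L-cong {X} {X'} {Y} {Y'} e f =
    ≈-trans (*L-congˡ Y e) (≈-trans (*L-comm X' Y) (≈-trans (*L-congˡ X' f) (*L-comm Y' X')))

  *L-distribʳ : ∀ X Y Z → ((Y +L Z) *L X) ≈ ((Y *L X) +L (Z *L X))
  *L-distribʳ (laurent a p) (laurent b r) (laurent c t) d =
    trans (laurent-cong N (≋-trans (⊗-distribʳ (shiftP c r) (shiftP b t) p) (⊕-cong (shift-⊗ c r p) (shift-⊗ b t p))) d)
      (trans (coeff-laurent N (shiftP c (r ⊗ p) ⊕ shiftP b (t ⊗ p)) d)
        (trans (coeffP-⊕ (d ℤ.+ + N) (shiftP c (r ⊗ p)) (shiftP b (t ⊗ p)))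
          (trans (cong₂ ℤ._+_
                   (trans (sym (coeff-laurent N (shiftP c (r ⊗ p)) d)) (laurent-shift (b ℕ.+ a) c (r ⊗ p) (swap₂₃ b a c) d))
                   (trans (sym (coeff-laurent N (shiftP b (t ⊗ p)) d)) (laurent-shift (c ℕ.+ a) b (t ⊗ p) (swap₁₃ c a b) d)))
            (sym (coeff-+ (laurent (b ℕ.+ a) (r ⊗ p)) (laurent (c ℕ.+ a) (t ⊗ p)) d)))))
    where
    N = (b ℕ.+ c) ℕ.+ a
    swap₂₃ : ∀ x y z → (x ℕ.+ y) ℕ.+ z ≡ (x ℕ.+ z) ℕ.+ y
    swap₂₃ = solve-∀
    swap₁₃ : ∀ x y z → (x ℕ.+ y) ℕ.+ z ≡ (z ℕ.+ x) ℕ.+ y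
    swap₁₃ = solve-∀

module LaurentRing where

  open CoefficientLists
  open LaurentPolynomials
  open import Algebra.Bundles using (CommutativeRing)
  open import Algebra.Structures using (IsCommutativeRing)
  import Algebra.Solver.Ring
  open import Algebra.Solver.Ring.AlmostCommutativeRing
    using (AlmostCommutativeRing; fromCommutativeRing; _-Raw-AlmostCommutative⟶_)
  open import Data.Integer as ℤ using (ℤ; 0ℤ; 1ℤ)
  import Data.Integer.Properties as ℤP
  open import Data.Maybe using (Maybe; just; nothing)
  open import Data.Product using (_,_)
  open import Level using (0ℓ)
  open import Relation.Binary.PropositionalEquality as ≡ using (_≡_; refl)
  open import Relation.Nullary using (yes; no)

  -- The ring operations are opaque copies of +L, *L, negL: the solver then
  -- compares normal forms syntactically instead of computing with coefficient lists.
  infixl 6 _⊞_ _⊟_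
  infixl 7 _⊠_
  opaque
    _⊞_ _⊠_ : Laurent → Laurent → Laurent
    _⊞_ = _+L_
    _⊠_ = _*L_

    ⊖_ : Laurent → Laurent
    ⊖_ = negL

    ⊞-unfold : ∀ X Y → X +L Y ≡ X ⊞ Y
    ⊞-unfold X Y = refl

    ⊠-unfold : ∀ X Y → X *L Y ≡ X ⊠ Y
    ⊠-unfold X Y = refl

    ⊖-unfold : ∀ X → negL X ≡ ⊖ X
    ⊖-unfold X = refl

  _⊟_ : Laurent → Laurent → Laurent
  X ⊟ Y = X ⊞ ⊖ Y

  𝟎 𝟏 : Laurent
  𝟎 = κ 0ℤ
  𝟏 = κ 1ℤ

  -- ≈ wrapped in a record, so that X and Y can be inferred from a proof of X ≃ Y.
  infix 4 _≃_
  record _≃_ (X Y : Laurent) : Set where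
    constructor mk≃
    field get : X ≈ Y
  open _≃_ public

  opaque
    unfolding _⊞_

    isCommutativeRing : IsCommutativeRing _≃_ _⊞_ _⊠_ ⊖_ 𝟎 𝟏
    isCommutativeRing = record
      { isRing = record
        { +-isAbelianGroup = record
          { isGroup = record
            { isMonoid = record
              { isSemigroup = record
                { isMagma = record
                  { isEquivalence = record
                    { refl = mk≃ ≈-refl
                    ; sym = λ e → mk≃ (≈-sym (get e))
                    ; trans = λ e f → mk≃ (≈-trans (get e) (get f)) }
                  ; ∙-cong = λ e f → mk≃ (+L-cong (get e) (get f)) }
                ; assoc = λ X Y Z → mk≃ (+L-assoc X Y Z) }
              ; identity = (λ X → mk≃ (+L-identityˡ X)) , (λ X → mk≃ (+L-identityʳ X)) }
            ; inverse = (λ X → mk≃ (negL-inverseˡ X)) , (λ X → mk≃ (negL-inverseʳ X))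
            ; ⁻¹-cong = λ e → mk≃ (negL-cong (get e)) }
          ; comm = λ X Y → mk≃ (+L-comm X Y) }
        ; *-cong = λ e f → mk≃ (*L-cong (get e) (get f))
        ; *-assoc = λ X Y Z → mk≃ (*L-assoc X Y Z)
        ; *-identity = (λ X → mk≃ (*L-identityˡ X)) , (λ X → mk≃ (*L-identityʳ X))
        ; distrib = (λ X Y Z → mk≃ (≈-trans (*L-comm X (Y +L Z))
                                    (≈-trans (*L-distribʳ X Y Z) (+L-cong (*L-comm Y X) (*L-comm Z X)))))
                  , (λ X Y Z → mk≃ (*L-distribʳ X Y Z)) }
      ; *-comm = λ X Y → mk≃ (*L-comm X Y) }

    κ-+ : ∀ x y → κ (x ℤ.+ y) ≃ κ x ⊞ κ y
    κ-+ x y = mk≃ ≈-refl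

    κ-* : ∀ x y → κ (x ℤ.* y) ≃ κ x ⊠ κ y
    κ-* x y = mk≃ (laurent-cong 0 (∷-cong (≡.sym (ℤP.+-identityʳ (x ℤ.* y))) ≋-refl))

    κ-neg : ∀ x → κ (ℤ.- x) ≃ ⊖ κ x
    κ-neg x = mk≃ ≈-refl

  Laurent-commutativeRing : CommutativeRing 0ℓ 0ℓ
  Laurent-commutativeRing = record { isCommutativeRing = isCommutativeRing }

  open CommutativeRing Laurent-commutativeRing public
    using (+-cong; *-cong; -‿cong) renaming (refl to ≃-refl; sym to ≃-sym; trans to ≃-trans)
  open import Relation.Binary.Reasoning.Setoid (CommutativeRing.setoid Laurent-commutativeRing) public

  κ-homomorphism : CommutativeRing.rawRing ℤP.+-*-commutativeRing
                     -Raw-AlmostCommutative⟶ fromCommutativeRing Laurent-commutativeRing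
  κ-homomorphism = record
    { ⟦_⟧ = κ ; +-homo = κ-+ ; *-homo = κ-* ; -‿homo = κ-neg ; 0-homo = ≃-refl ; 1-homo = ≃-refl }

  κ-equal? : (x y : ℤ) → Maybe (κ x ≃ κ y)
  κ-equal? x y with x ℤP.≟ y
  ... | yes refl = just ≃-refl
  ... | no _ = nothing

  open Algebra.Solver.Ring (CommutativeRing.rawRing ℤP.+-*-commutativeRing)
    (fromCommutativeRing Laurent-commutativeRing) κ-homomorphism κ-equal? public
    using (solve; _:=_; _:+_; _:*_; _:-_; con)

  ≡⇒≃ : ∀ {X Y} → X ≡ Y → X ≃ Y
  ≡⇒≃ refl = ≃-refl

  +L≃⊞ : ∀ X Y → X +L Y ≃ X ⊞ Y
  +L≃⊞ X Y = ≡⇒≃ (⊞-unfold X Y)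

  *L≃⊠ : ∀ X Y → X *L Y ≃ X ⊠ Y
  *L≃⊠ X Y = ≡⇒≃ (⊠-unfold X Y)

  -L≃⊟ : ∀ X Y → X -L Y ≃ X ⊟ Y
  -L≃⊟ X Y = ≡⇒≃ (≡.trans (⊞-unfold X (negL Y)) (≡.cong (X ⊞_) (⊖-unfold Y)))

  zeroL≃𝟎 : zeroL ≃ 𝟎
  zeroL≃𝟎 = mk≃ zeroL≈κ0

  -- Chained, it proves an identity from
  -- several hypotheses given their coefficients (a certificate).
  using-difference : ∀ {L R A B} c → A ≃ B → L ≃ R ⊞ c ⊠ (A ⊟ B) → L ≃ R
  using-difference {L} {R} {A} {B} c A≃B L≃R+c[A-B] = begin
    L                   ≈⟨ L≃R+c[A-B] ⟩
    R ⊞ c ⊠ (A ⊟ B)     ≈⟨ +-cong ≃-refl (*-cong ≃-refl (+-cong A≃B ≃-refl)) ⟩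
    R ⊞ c ⊠ (B ⊟ B)     ≈⟨ solve 3 (λ r c b → r :+ c :* (b :- b) := r) ≃-refl R c B ⟩
    R                   ∎

  cancel-unit : ∀ {u v L R} → v ⊠ u ≃ 𝟏 → u ⊠ L ≃ u ⊠ R → L ≃ R
  cancel-unit {u} {v} {L} {R} vu≃1 uL≃uR = begin
    L              ≈⟨ solve 1 (λ x → x := con 1ℤ :* x) ≃-refl L ⟩
    𝟏 ⊠ L          ≈⟨ *-cong (≃-sym vu≃1) ≃-refl ⟩
    v ⊠ u ⊠ L      ≈⟨ solve 3 (λ a b c → a :* b :* c := a :* (b :* c)) ≃-refl v u L ⟩
    v ⊠ (u ⊠ L)    ≈⟨ *-cong ≃-refl uL≃uR ⟩
    v ⊠ (u ⊠ R)    ≈⟨ solve 3 (λ a b c → a :* (b :* c) := a :* b :* c) ≃-refl v u R ⟩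
    v ⊠ u ⊠ R      ≈⟨ *-cong vu≃1 ≃-refl ⟩
    𝟏 ⊠ R          ≈⟨ solve 1 (λ x → con 1ℤ :* x := x) ≃-refl R ⟩
    R              ∎

module SumsAndPowers where

  open CoefficientLists
  open LaurentPolynomials
  open LaurentRing
  open import Data.Nat as ℕ using (ℕ; zero; suc)
  import Data.Nat.Properties as ℕP
  open import Data.Integer as ℤ using (ℤ; +_; -[1+_]; 0ℤ; 1ℤ)
  import Data.Integer.Properties as ℤP
  open import Data.Integer.Tactic.RingSolver using (solve-∀)
  open import Data.List using ([]; _∷_; applyUpTo)
  open import Data.Product using (Σ; _,_)
  open import Relation.Binary.PropositionalEquality as ≡ using (_≡_; refl; cong; cong₂)

  sumUpTo prodUpTo : (ℕ → Laurent) → ℕ → Laurent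
  sumUpTo f m = sumL (applyUpTo f m)
  prodUpTo f m = prodL (applyUpTo f m)

  sumUpTo-suc : ∀ f m → sumUpTo f (suc m) ≃ f 0 ⊞ sumUpTo (λ j → f (suc j)) m
  sumUpTo-suc f m = +L≃⊞ (f 0) (sumUpTo (λ j → f (suc j)) m)

  sumUpTo-single : ∀ f → sumUpTo f 1 ≃ f 0
  sumUpTo-single f = begin
    sumUpTo f 1    ≈⟨ sumUpTo-suc f 0 ⟩
    f 0 ⊞ zeroL    ≈⟨ +-cong ≃-refl zeroL≃𝟎 ⟩
    f 0 ⊞ 𝟎        ≈⟨ solve 1 (λ x → x :+ con 0ℤ := x) ≃-refl (f 0) ⟩
    f 0            ∎

  sumUpTo-snoc : ∀ f m → sumUpTo f (suc m) ≃ sumUpTo f m ⊞ f m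
  sumUpTo-snoc f zero = begin
    sumUpTo f 1      ≈⟨ sumUpTo-suc f 0 ⟩
    f 0 ⊞ zeroL      ≈⟨ +-cong ≃-refl zeroL≃𝟎 ⟩
    f 0 ⊞ 𝟎          ≈⟨ solve 1 (λ x → x :+ con 0ℤ := con 0ℤ :+ x) ≃-refl (f 0) ⟩
    𝟎 ⊞ f 0          ≈⟨ +-cong (≃-sym zeroL≃𝟎) ≃-refl ⟩
    zeroL ⊞ f 0      ∎
  sumUpTo-snoc f (suc m) = begin
    sumUpTo f (suc (suc m))                          ≈⟨ sumUpTo-suc f (suc m) ⟩
    f 0 ⊞ sumUpTo f′ (suc m)                         ≈⟨ +-cong ≃-refl (sumUpTo-snoc f′ m) ⟩
    f 0 ⊞ (sumUpTo f′ m ⊞ f (suc m))                 ≈⟨ solve 3 (λ x y z → x :+ (y :+ z) := x :+ y :+ z) ≃-refl (f 0) _ _ ⟩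
    f 0 ⊞ sumUpTo f′ m ⊞ f (suc m)                   ≈⟨ +-cong (≃-sym (sumUpTo-suc f m)) ≃-refl ⟩
    sumUpTo f (suc m) ⊞ f (suc m)                    ∎
    where f′ = λ j → f (suc j)

  sumUpTo-cong : ∀ {f g} m → (∀ j → j ℕ.< m → f j ≃ g j) → sumUpTo f m ≃ sumUpTo g m
  sumUpTo-cong zero f≃g = ≃-refl
  sumUpTo-cong {f} {g} (suc m) f≃g = begin
    sumUpTo f (suc m)                        ≈⟨ sumUpTo-suc f m ⟩
    f 0 ⊞ sumUpTo (λ j → f (suc j)) m        ≈⟨ +-cong (f≃g 0 (ℕ.s≤s ℕ.z≤n)) (sumUpTo-cong m (λ j j<m → f≃g (suc j) (ℕ.s≤s j<m))) ⟩
    g 0 ⊞ sumUpTo (λ j → g (suc j)) m        ≈⟨ ≃-sym (sumUpTo-suc g m) ⟩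
    sumUpTo g (suc m)                        ∎

  sumUpTo-scale : ∀ c f m → sumUpTo (λ j → c ⊠ f j) m ≃ c ⊠ sumUpTo f m
  sumUpTo-scale c f zero = begin
    zeroL       ≈⟨ zeroL≃𝟎 ⟩
    𝟎           ≈⟨ solve 1 (λ x → con 0ℤ := x :* con 0ℤ) ≃-refl c ⟩
    c ⊠ 𝟎       ≈⟨ *-cong ≃-refl (≃-sym zeroL≃𝟎) ⟩
    c ⊠ zeroL   ∎
  sumUpTo-scale c f (suc m) = begin
    sumUpTo (λ j → c ⊠ f j) (suc m)            ≈⟨ sumUpTo-suc (λ j → c ⊠ f j) m ⟩
    c ⊠ f 0 ⊞ sumUpTo (λ j → c ⊠ f′ j) m       ≈⟨ +-cong ≃-refl (sumUpTo-scale c f′ m) ⟩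
    c ⊠ f 0 ⊞ c ⊠ sumUpTo f′ m                 ≈⟨ solve 3 (λ x y z → x :* y :+ x :* z := x :* (y :+ z)) ≃-refl c (f 0) _ ⟩
    c ⊠ (f 0 ⊞ sumUpTo f′ m)                   ≈⟨ *-cong ≃-refl (≃-sym (sumUpTo-suc f m)) ⟩
    c ⊠ sumUpTo f (suc m)                      ∎
    where f′ = λ j → f (suc j)

  sumUpTo-sub : ∀ f g m → sumUpTo (λ j → f j ⊟ g j) m ≃ sumUpTo f m ⊟ sumUpTo g m
  sumUpTo-sub f g zero = begin
    zeroL            ≈⟨ zeroL≃𝟎 ⟩
    𝟎                ≈⟨ solve 0 (con 0ℤ := con 0ℤ :- con 0ℤ) ≃-refl ⟩
    𝟎 ⊟ 𝟎            ≈⟨ +-cong (≃-sym zeroL≃𝟎) (-‿cong (≃-sym zeroL≃𝟎)) ⟩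
    zeroL ⊟ zeroL    ∎
  sumUpTo-sub f g (suc m) = begin
    sumUpTo (λ j → f j ⊟ g j) (suc m)                     ≈⟨ sumUpTo-suc (λ j → f j ⊟ g j) m ⟩
    (f 0 ⊟ g 0) ⊞ sumUpTo (λ j → f′ j ⊟ g′ j) m           ≈⟨ +-cong ≃-refl (sumUpTo-sub f′ g′ m) ⟩
    (f 0 ⊟ g 0) ⊞ (sumUpTo f′ m ⊟ sumUpTo g′ m)           ≈⟨ solve 4 (λ a b c d → (a :- b) :+ (c :- d) := (a :+ c) :- (b :+ d)) ≃-refl (f 0) (g 0) _ _ ⟩
    (f 0 ⊞ sumUpTo f′ m) ⊟ (g 0 ⊞ sumUpTo g′ m)           ≈⟨ +-cong (≃-sym (sumUpTo-suc f m)) (-‿cong (≃-sym (sumUpTo-suc g m))) ⟩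
    sumUpTo f (suc m) ⊟ sumUpTo g (suc m)                 ∎
    where
    f′ = λ j → f (suc j)
    g′ = λ j → g (suc j)

  prodUpTo-suc : ∀ f m → prodUpTo f (suc m) ≃ f 0 ⊠ prodUpTo (λ j → f (suc j)) m
  prodUpTo-suc f m = *L≃⊠ (f 0) (prodUpTo (λ j → f (suc j)) m)

  prodUpTo-snoc : ∀ f m → prodUpTo f (suc m) ≃ prodUpTo f m ⊠ f m
  prodUpTo-snoc f zero = begin
    f 0 *L oneL   ≈⟨ *L≃⊠ (f 0) oneL ⟩
    f 0 ⊠ 𝟏       ≈⟨ solve 1 (λ x → x :* con 1ℤ := con 1ℤ :* x) ≃-refl (f 0) ⟩
    𝟏 ⊠ f 0       ∎
  prodUpTo-snoc f (suc m) = begin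
    prodUpTo f (suc (suc m))                  ≈⟨ prodUpTo-suc f (suc m) ⟩
    f 0 ⊠ prodUpTo f′ (suc m)                 ≈⟨ *-cong ≃-refl (prodUpTo-snoc f′ m) ⟩
    f 0 ⊠ (prodUpTo f′ m ⊠ f (suc m))         ≈⟨ solve 3 (λ x y z → x :* (y :* z) := x :* y :* z) ≃-refl (f 0) _ _ ⟩
    f 0 ⊠ prodUpTo f′ m ⊠ f (suc m)           ≈⟨ *-cong (≃-sym (prodUpTo-suc f m)) ≃-refl ⟩
    prodUpTo f (suc m) ⊠ f (suc m)            ∎
    where f′ = λ j → f (suc j)

  monomial : ℕ → ℕ → Laurent
  monomial a b = laurent a (shiftP b (1ℤ ∷ []))

  monomial-shift : ∀ a b c → monomial (a ℕ.+ c) (b ℕ.+ c) ≈ monomial a b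
  monomial-shift a b c =
    ≈-trans (laurent-cong (a ℕ.+ c) (mk≋ λ i → cong (λ p → lookupZ p i)
              (≡.trans (cong (λ t → shiftP t (1ℤ ∷ [])) (ℕP.+-comm b c)) (≡.sym (shift-shift c b (1ℤ ∷ []))))))
      (laurent-shift a c (shiftP b (1ℤ ∷ [])) refl)

  qpow≈monomial : ∀ z a b → + b ≡ z ℤ.+ + a → qpow z ≈ monomial a b
  qpow≈monomial (+ m) a b e with ℤP.+-injective e
  ... | refl = ≈-sym (monomial-shift 0 m a)
  qpow≈monomial -[1+ m ] a b e with ℤP.+-injective a≡1+m+b
    where
    a≡1+m+b : + a ≡ + (suc m ℕ.+ b)
    a≡1+m+b = ≡.trans (≡.sym (ℤP.+-identityˡ (+ a)))
      (≡.trans (cong (ℤ._+ + a) (≡.sym (ℤP.+-inverseʳ (+ suc m))))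
        (≡.trans (ℤP.+-assoc (+ suc m) -[1+ m ] (+ a)) (cong (ℤ._+_ (+ suc m)) (≡.sym e))))
  ... | refl = ≈-sym (monomial-shift (suc m) 0 b)

  monomial-form : ∀ z → Σ ℕ λ a → Σ ℕ λ b → + b ≡ z ℤ.+ + a
  monomial-form (+ m) = 0 , m , ≡.sym (ℤP.+-identityʳ (+ m))
  monomial-form -[1+ m ] = suc m , 0 , ≡.sym (ℤP.+-inverseˡ (+ suc m))

  monomial-* : ∀ a b c d → (monomial a b *L monomial c d) ≈ monomial (a ℕ.+ c) (b ℕ.+ d)
  monomial-* a b c d = laurent-cong (a ℕ.+ c)
    (≋-trans (shift-⊗ b (1ℤ ∷ []) (shiftP d (1ℤ ∷ [])))
      (≋-trans (shift-cong b (⊗-identityˡ (shiftP d (1ℤ ∷ []))))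
        (mk≋ λ i → cong (λ p → lookupZ p i) (shift-shift b d (1ℤ ∷ [])))))

  qpow-+ : ∀ x y → qpow x ⊠ qpow y ≃ qpow (x ℤ.+ y)
  qpow-+ x y with monomial-form x | monomial-form y
  ... | a , b , ex | c , d , ey = begin
    qpow x ⊠ qpow y                ≈⟨ *-cong (mk≃ (qpow≈monomial x a b ex)) (mk≃ (qpow≈monomial y c d ey)) ⟩
    monomial a b ⊠ monomial c d    ≈⟨ ≃-sym (*L≃⊠ (monomial a b) (monomial c d)) ⟩
    monomial a b *L monomial c d   ≈⟨ mk≃ (monomial-* a b c d) ⟩
    monomial (a ℕ.+ c) (b ℕ.+ d)   ≈⟨ mk≃ (≈-sym (qpow≈monomial (x ℤ.+ y) (a ℕ.+ c) (b ℕ.+ d) exponents)) ⟩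
    qpow (x ℤ.+ y)                 ∎
    where
    interchange : ∀ x y a c → (x ℤ.+ a) ℤ.+ (y ℤ.+ c) ≡ (x ℤ.+ y) ℤ.+ (a ℤ.+ c)
    interchange = solve-∀
    exponents : + (b ℕ.+ d) ≡ (x ℤ.+ y) ℤ.+ + (a ℕ.+ c)
    exponents = ≡.trans (cong₂ ℤ._+_ ex ey) (interchange x y (+ a) (+ c))

  qpow-cong : ∀ {x y} → x ≡ y → qpow x ≃ qpow y
  qpow-cong refl = ≃-refl

  qpow-+≡ : ∀ x y z → x ℤ.+ y ≡ z → qpow x ⊠ qpow y ≃ qpow z
  qpow-+≡ x y z x+y≡z = ≃-trans (qpow-+ x y) (qpow-cong x+y≡z)

  q^_ : ℕ → Laurent
  q^ m = qpowℕ m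

  q^-suc : ∀ m → q^ (suc m) ≃ q^ 1 ⊠ q^ m
  q^-suc m = ≃-sym (qpow-+ (+ 1) (+ m))

  q^-+ : ∀ m n → q^ m ⊠ q^ n ≃ q^ (m ℕ.+ n)
  q^-+ m n = qpow-+ (+ m) (+ n)

  q^-cancel : ∀ j {L R} → q^ j ⊠ L ≃ q^ j ⊠ R → L ≃ R
  q^-cancel j = cancel-unit (qpow-+≡ (ℤ.- (+ j)) (+ j) 0ℤ (ℤP.+-inverseˡ (+ j)))

module QAnalogues where

  open LaurentRing
  open SumsAndPowers
  open import Data.Nat as ℕ using (ℕ; zero; suc)
  import Data.Nat.Properties as ℕP
  open import Data.Integer as ℤ using (0ℤ; 1ℤ)
  open LaurentPolynomials using (κ)
  open import Data.List.Properties using (map-upTo)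
  open import Relation.Binary.PropositionalEquality as ≡ using (_≡_; cong)

  qint-zero : qint 0 ≃ 𝟎
  qint-zero = zeroL≃𝟎

  qint-suc : ∀ m → qint (suc m) ≃ qint m ⊞ q^ m
  qint-suc m = begin
    qint (suc m)             ≈⟨ ≡⇒≃ (cong sumL (map-upTo q^_ (suc m))) ⟩
    sumUpTo q^_ (suc m)      ≈⟨ sumUpTo-snoc q^_ m ⟩
    sumUpTo q^_ m ⊞ q^ m     ≈⟨ +-cong (≡⇒≃ (cong sumL (≡.sym (map-upTo q^_ m)))) ≃-refl ⟩
    qint m ⊞ q^ m            ∎

  qint-one : qint 1 ≃ 𝟏
  qint-one = begin
    qint 1          ≈⟨ qint-suc 0 ⟩
    qint 0 ⊞ q^ 0   ≈⟨ +-cong qint-zero ≃-refl ⟩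
    𝟎 ⊞ 𝟏           ≈⟨ solve 0 (con 0ℤ :+ con 1ℤ := con 1ℤ) ≃-refl ⟩
    𝟏               ∎

  qint-times-1-q : ∀ m → (𝟏 ⊟ q^ 1) ⊠ qint m ≃ 𝟏 ⊟ q^ m
  qint-times-1-q zero = begin
    (𝟏 ⊟ q^ 1) ⊠ qint 0   ≈⟨ *-cong ≃-refl qint-zero ⟩
    (𝟏 ⊟ q^ 1) ⊠ 𝟎        ≈⟨ solve 1 (λ q → (con 1ℤ :- q) :* con 0ℤ := con 1ℤ :- con 1ℤ) ≃-refl (q^ 1) ⟩
    𝟏 ⊟ q^ 0              ∎
  qint-times-1-q (suc m) = begin
    (𝟏 ⊟ q^ 1) ⊠ qint (suc m)                            ≈⟨ *-cong ≃-refl (qint-suc m) ⟩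
    (𝟏 ⊟ q^ 1) ⊠ (qint m ⊞ q^ m)                         ≈⟨ solve 3 (λ q x y → (con 1ℤ :- q) :* (x :+ y) := (con 1ℤ :- q) :* x :+ y :- q :* y) ≃-refl (q^ 1) (qint m) (q^ m) ⟩
    (𝟏 ⊟ q^ 1) ⊠ qint m ⊞ q^ m ⊟ q^ 1 ⊠ q^ m              ≈⟨ +-cong (+-cong (qint-times-1-q m) ≃-refl) (-‿cong (≃-sym (q^-suc m))) ⟩
    (𝟏 ⊟ q^ m) ⊞ q^ m ⊟ q^ (suc m)                        ≈⟨ solve 2 (λ y z → (con 1ℤ :- y) :+ y :- z := con 1ℤ :- z) ≃-refl (q^ m) (q^ (suc m)) ⟩
    𝟏 ⊟ q^ (suc m)                                       ∎

  qint-+ : ∀ a b → qint (a ℕ.+ b) ≃ qint a ⊞ q^ a ⊠ qint b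
  qint-+ a zero = begin
    qint (a ℕ.+ 0)            ≈⟨ ≡⇒≃ (cong qint (ℕP.+-identityʳ a)) ⟩
    qint a                    ≈⟨ solve 2 (λ x y → x := x :+ y :* con 0ℤ) ≃-refl (qint a) (q^ a) ⟩
    qint a ⊞ q^ a ⊠ 𝟎         ≈⟨ +-cong ≃-refl (*-cong ≃-refl (≃-sym qint-zero)) ⟩
    qint a ⊞ q^ a ⊠ qint 0    ∎
  qint-+ a (suc b) = begin
    qint (a ℕ.+ suc b)                          ≈⟨ ≡⇒≃ (cong qint (ℕP.+-suc a b)) ⟩
    qint (suc (a ℕ.+ b))                        ≈⟨ qint-suc (a ℕ.+ b) ⟩
    qint (a ℕ.+ b) ⊞ q^ (a ℕ.+ b)               ≈⟨ +-cong (qint-+ a b) (≃-sym (q^-+ a b)) ⟩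
    qint a ⊞ q^ a ⊠ qint b ⊞ q^ a ⊠ q^ b        ≈⟨ solve 4 (λ x y z w → x :+ y :* z :+ y :* w := x :+ y :* (z :+ w)) ≃-refl (qint a) (q^ a) (qint b) (q^ b) ⟩
    qint a ⊞ q^ a ⊠ (qint b ⊞ q^ b)             ≈⟨ +-cong ≃-refl (*-cong ≃-refl (≃-sym (qint-suc b))) ⟩
    qint a ⊞ q^ a ⊠ qint (suc b)                ∎

  qint-suc′ : ∀ n → 𝟏 ⊞ q^ 1 ⊠ qint n ≃ qint n ⊞ q^ n
  qint-suc′ n = begin
    𝟏 ⊞ q^ 1 ⊠ qint n        ≈⟨ +-cong (≃-sym qint-one) ≃-refl ⟩
    qint 1 ⊞ q^ 1 ⊠ qint n   ≈⟨ ≃-sym (qint-+ 1 n) ⟩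
    qint (suc n)             ≈⟨ qint-suc n ⟩
    qint n ⊞ q^ n            ∎

  qbinom-pascal : ∀ n k → qbinom (suc n) (suc k) ≃ qbinom n k ⊞ q^ (suc k) ⊠ qbinom n (suc k)
  qbinom-pascal n k =
    ≃-trans (+L≃⊞ (qbinom n k) _) (+-cong ≃-refl (*L≃⊠ (q^ (suc k)) (qbinom n (suc k))))

  qbinom-empty : ∀ k → qbinom 0 (suc k) ≃ 𝟎
  qbinom-empty k = zeroL≃𝟎

  qbinom-one : ∀ n → qbinom n 1 ≃ qint n
  qbinom-one zero = ≃-trans (qbinom-empty 0) (≃-sym qint-zero)
  qbinom-one (suc n) = begin
    qbinom (suc n) 1                   ≈⟨ qbinom-pascal n 0 ⟩
    qbinom n 0 ⊞ q^ 1 ⊠ qbinom n 1     ≈⟨ +-cong (≃-sym qint-one) (*-cong ≃-refl (qbinom-one n)) ⟩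
    qint 1 ⊞ q^ 1 ⊠ qint n             ≈⟨ ≃-sym (qint-+ 1 n) ⟩
    qint (suc n)                       ∎

  qbinom-ratio : ∀ n k → (q^ (suc k) ⊟ q^ (suc n)) ⊠ qbinom n k ≃ q^ (suc k) ⊠ (𝟏 ⊟ q^ (suc k)) ⊠ qbinom n (suc k)
  qbinom-ratio zero zero = begin
    (q^ 1 ⊟ q^ 1) ⊠ qbinom 0 0         ≈⟨ solve 1 (λ q → (q :- q) :* con 1ℤ := q :* (con 1ℤ :- q) :* con 0ℤ) ≃-refl (q^ 1) ⟩
    q^ 1 ⊠ (𝟏 ⊟ q^ 1) ⊠ 𝟎              ≈⟨ *-cong ≃-refl (≃-sym (qbinom-empty 0)) ⟩
    q^ 1 ⊠ (𝟏 ⊟ q^ 1) ⊠ qbinom 0 1     ∎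
  qbinom-ratio zero (suc k) = begin
    (v ⊟ q^ 1) ⊠ qbinom 0 (suc k)      ≈⟨ *-cong ≃-refl (qbinom-empty k) ⟩
    (v ⊟ q^ 1) ⊠ 𝟎                     ≈⟨ solve 2 (λ v q → (v :- q) :* con 0ℤ := v :* (con 1ℤ :- v) :* con 0ℤ) ≃-refl v (q^ 1) ⟩
    v ⊠ (𝟏 ⊟ v) ⊠ 𝟎                    ≈⟨ *-cong ≃-refl (≃-sym (qbinom-empty (suc k))) ⟩
    v ⊠ (𝟏 ⊟ v) ⊠ qbinom 0 (suc (suc k)) ∎
    where v = q^ (suc (suc k))
  qbinom-ratio (suc n) zero = begin
    (q^ 1 ⊟ q^ (suc (suc n))) ⊠ qbinom (suc n) 0   ≈⟨ *-cong (+-cong ≃-refl (-‿cong (q^-suc (suc n)))) ≃-refl ⟩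
    (q^ 1 ⊟ q^ 1 ⊠ q^ (suc n)) ⊠ 𝟏                ≈⟨ solve 2 (λ q w → (q :- q :* w) :* con 1ℤ := q :* (con 1ℤ :- w)) ≃-refl (q^ 1) (q^ (suc n)) ⟩
    q^ 1 ⊠ (𝟏 ⊟ q^ (suc n))                        ≈⟨ *-cong ≃-refl (≃-sym (qint-times-1-q (suc n))) ⟩
    q^ 1 ⊠ ((𝟏 ⊟ q^ 1) ⊠ qint (suc n))             ≈⟨ solve 3 (λ q a b → q :* (a :* b) := q :* a :* b) ≃-refl (q^ 1) (𝟏 ⊟ q^ 1) (qint (suc n)) ⟩
    q^ 1 ⊠ (𝟏 ⊟ q^ 1) ⊠ qint (suc n)               ≈⟨ *-cong ≃-refl (≃-sym (qbinom-one (suc n))) ⟩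
    q^ 1 ⊠ (𝟏 ⊟ q^ 1) ⊠ qbinom (suc n) 1           ∎
  qbinom-ratio (suc n) (suc k) = begin
    (v ⊟ q^ (suc (suc n))) ⊠ qbinom (suc n) (suc k)   ≈⟨ *-cong (+-cong v≃qu (-‿cong (q^-suc (suc n)))) (qbinom-pascal n k) ⟩
    (q ⊠ u ⊟ q ⊠ w) ⊠ (X ⊞ u ⊠ Y)                     ≈⟨ using-difference q (qbinom-ratio n k) (using-difference (q ⊠ u) ratio′
                                                           (solve 6 (λ q u w X Y Z →
                                                              (q :* u :- q :* w) :* (X :+ u :* Y)
                                                              := q :* u :* (con 1ℤ :- q :* u) :* (Y :+ q :* u :* Z)
                                                                 :+ q :* ((u :- w) :* X :- u :* (con 1ℤ :- u) :* Y)
                                                                 :+ q :* u :* ((q :* u :- w) :* Y :- q :* u :* (con 1ℤ :- q :* u) :* Z))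
                                                              ≃-refl q u w X Y Z)) ⟩
    q ⊠ u ⊠ (𝟏 ⊟ q ⊠ u) ⊠ (Y ⊞ q ⊠ u ⊠ Z)             ≈⟨ ≃-sym (*-cong (*-cong v≃qu (+-cong ≃-refl (-‿cong v≃qu))) (+-cong ≃-refl (*-cong v≃qu ≃-refl))) ⟩
    v ⊠ (𝟏 ⊟ v) ⊠ (Y ⊞ v ⊠ Z)                         ≈⟨ *-cong ≃-refl (≃-sym (qbinom-pascal n (suc k))) ⟩
    v ⊠ (𝟏 ⊟ v) ⊠ qbinom (suc n) (suc (suc k))        ∎
    where
    q = q^ 1
    u = q^ (suc k)
    v = q^ (suc (suc k))
    w = q^ (suc n)
    X = qbinom n k
    Y = qbinom n (suc k)
    Z = qbinom n (suc (suc k))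
    v≃qu : v ≃ q ⊠ u
    v≃qu = q^-suc (suc k)
    ratio′ : (q ⊠ u ⊟ w) ⊠ Y ≃ q ⊠ u ⊠ (𝟏 ⊟ q ⊠ u) ⊠ Z
    ratio′ = begin
      (q ⊠ u ⊟ w) ⊠ Y          ≈⟨ *-cong (+-cong (≃-sym v≃qu) ≃-refl) ≃-refl ⟩
      (v ⊟ w) ⊠ Y              ≈⟨ qbinom-ratio n (suc k) ⟩
      v ⊠ (𝟏 ⊟ v) ⊠ Z          ≈⟨ *-cong (*-cong v≃qu (+-cong ≃-refl (-‿cong v≃qu))) ≃-refl ⟩
      q ⊠ u ⊠ (𝟏 ⊟ q ⊠ u) ⊠ Z  ∎

  qbinom-absorption : ∀ n k → qint (suc k) ⊠ qbinom (suc n) (suc k) ≃ qint (suc n) ⊠ qbinom n k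
  qbinom-absorption zero zero = begin
    qint 1 ⊠ qbinom 1 1          ≈⟨ *-cong ≃-refl (≃-trans (qbinom-pascal 0 0) (+-cong ≃-refl (*-cong ≃-refl (qbinom-empty 0)))) ⟩
    qint 1 ⊠ (𝟏 ⊞ q^ 1 ⊠ 𝟎)      ≈⟨ solve 2 (λ a q → a :* (con 1ℤ :+ q :* con 0ℤ) := a :* con 1ℤ) ≃-refl (qint 1) (q^ 1) ⟩
    qint 1 ⊠ qbinom 0 0          ∎
  qbinom-absorption zero (suc k) = begin
    qint (suc (suc k)) ⊠ qbinom 1 (suc (suc k))      ≈⟨ *-cong ≃-refl (≃-trans (qbinom-pascal 0 (suc k)) (+-cong (qbinom-empty k) (*-cong ≃-refl (qbinom-empty (suc k))))) ⟩
    qint (suc (suc k)) ⊠ (𝟎 ⊞ q^ (suc (suc k)) ⊠ 𝟎)  ≈⟨ solve 3 (λ a b v → a :* (con 0ℤ :+ v :* con 0ℤ) := b :* con 0ℤ) ≃-refl (qint (suc (suc k))) (qint 1) (q^ (suc (suc k))) ⟩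
    qint 1 ⊠ 𝟎                                       ≈⟨ *-cong ≃-refl (≃-sym (qbinom-empty k)) ⟩
    qint 1 ⊠ qbinom 0 (suc k)                        ∎
  qbinom-absorption (suc n) zero = begin
    qint 1 ⊠ qbinom (suc (suc n)) 1     ≈⟨ *-cong qint-one (qbinom-one (suc (suc n))) ⟩
    𝟏 ⊠ qint (suc (suc n))              ≈⟨ solve 1 (λ a → con 1ℤ :* a := a :* con 1ℤ) ≃-refl (qint (suc (suc n))) ⟩
    qint (suc (suc n)) ⊠ qbinom (suc n) 0 ∎
  qbinom-absorption (suc n) (suc k) = begin
    qint (suc (suc k)) ⊠ qbinom (suc (suc n)) (suc (suc k))   ≈⟨ *-cong (qint-suc (suc k)) (qbinom-pascal (suc n) (suc k)) ⟩
    (K ⊞ u) ⊠ (Bc ⊞ v ⊠ Bd)                                   ≈⟨ solve 5 (λ K u Bc v Bd → (K :+ u) :* (Bc :+ v :* Bd) := K :* Bc :+ u :* Bc :+ v :* ((K :+ u) :* Bd)) ≃-refl K u Bc v Bd ⟩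
    K ⊠ Bc ⊞ u ⊠ Bc ⊞ v ⊠ ((K ⊞ u) ⊠ Bd)                      ≈⟨ +-cong (+-cong (qbinom-absorption n k) (*-cong ≃-refl (qbinom-pascal n k))) (*-cong ≃-refl absorption-above) ⟩
    N ⊠ X ⊞ u ⊠ (X ⊞ u ⊠ Y) ⊞ v ⊠ (N ⊠ Y)                     ≈⟨ regroup ⟩
    (N ⊞ w) ⊠ (X ⊞ u ⊠ Y)                                     ≈⟨ *-cong (≃-sym (qint-suc (suc n))) (≃-sym (qbinom-pascal n k)) ⟩
    qint (suc (suc n)) ⊠ qbinom (suc n) (suc k)               ∎
    where
    q = q^ 1
    u = q^ (suc k)
    v = q^ (suc (suc k))
    w = q^ (suc n)
    K = qint (suc k)
    N = qint (suc n)
    X = qbinom n k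
    Y = qbinom n (suc k)
    Bc = qbinom (suc n) (suc k)
    Bd = qbinom (suc n) (suc (suc k))
    absorption-above : (K ⊞ u) ⊠ Bd ≃ N ⊠ Y
    absorption-above = ≃-trans (*-cong (≃-sym (qint-suc (suc k))) ≃-refl) (qbinom-absorption n (suc k))
    regroup : N ⊠ X ⊞ u ⊠ (X ⊞ u ⊠ Y) ⊞ v ⊠ (N ⊠ Y) ≃ (N ⊞ w) ⊠ (X ⊞ u ⊠ Y)
    regroup =
      using-difference 𝟏 (qbinom-ratio n k) (using-difference (u ⊠ Y) (qint-suc′ (suc n)) (using-difference (N ⊠ Y) (q^-suc (suc k))
        (solve 7 (λ q u v w N X Y →
           N :* X :+ u :* (X :+ u :* Y) :+ v :* (N :* Y)
           := (N :+ w) :* (X :+ u :* Y)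
              :+ con 1ℤ :* ((u :- w) :* X :- u :* (con 1ℤ :- u) :* Y)
              :+ u :* Y :* ((con 1ℤ :+ q :* N) :- (N :+ w))
              :+ N :* Y :* (v :- q :* u))
           ≃-refl q u v w N X Y)))

  qint-identity-times-1-q : ∀ a b {X Y} → qint a ⊠ X ≃ qint b ⊠ Y → (𝟏 ⊟ q^ a) ⊠ X ≃ (𝟏 ⊟ q^ b) ⊠ Y
  qint-identity-times-1-q a b {X} {Y} [a]X≃[b]Y = begin
    (𝟏 ⊟ q^ a) ⊠ X                ≈⟨ *-cong (≃-sym (qint-times-1-q a)) ≃-refl ⟩
    (𝟏 ⊟ q^ 1) ⊠ qint a ⊠ X       ≈⟨ solve 3 (λ c x y → c :* x :* y := c :* (x :* y)) ≃-refl (𝟏 ⊟ q^ 1) (qint a) X ⟩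
    (𝟏 ⊟ q^ 1) ⊠ (qint a ⊠ X)     ≈⟨ *-cong ≃-refl [a]X≃[b]Y ⟩
    (𝟏 ⊟ q^ 1) ⊠ (qint b ⊠ Y)     ≈⟨ solve 3 (λ c x y → c :* (x :* y) := c :* x :* y) ≃-refl (𝟏 ⊟ q^ 1) (qint b) Y ⟩
    (𝟏 ⊟ q^ 1) ⊠ qint b ⊠ Y       ≈⟨ *-cong (qint-times-1-q b) ≃-refl ⟩
    (𝟏 ⊟ q^ b) ⊠ Y                ∎

  qbinom-absorption′ : ∀ n k → (𝟏 ⊟ q^ (suc k)) ⊠ qbinom (suc n) (suc k) ≃ (𝟏 ⊟ q^ (suc n)) ⊠ qbinom n k
  qbinom-absorption′ n k = qint-identity-times-1-q (suc k) (suc n) (qbinom-absorption n k)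

  qbinom-difference : ∀ n j → (qint (suc n) ⊟ qint j) ⊠ qbinom (suc n) j ≃ q^ j ⊠ qint (suc n) ⊠ qbinom n j
  qbinom-difference n zero = begin
    (qint (suc n) ⊟ qint 0) ⊠ qbinom (suc n) 0   ≈⟨ *-cong (+-cong ≃-refl (-‿cong qint-zero)) ≃-refl ⟩
    (qint (suc n) ⊟ 𝟎) ⊠ 𝟏                      ≈⟨ solve 1 (λ a → (a :- con 0ℤ) :* con 1ℤ := con 1ℤ :* a :* con 1ℤ) ≃-refl (qint (suc n)) ⟩
    q^ 0 ⊠ qint (suc n) ⊠ qbinom n 0             ∎
  qbinom-difference n (suc k) =
    using-difference (κ (ℤ.- 1ℤ)) (qbinom-absorption n k) (using-difference N (qbinom-pascal n k)
      (solve 6 (λ N K Bc u X Y →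
         (N :- K) :* Bc := u :* N :* Y :+ con (ℤ.- 1ℤ) :* (K :* Bc :- N :* X) :+ N :* (Bc :- (X :+ u :* Y)))
         ≃-refl N (qint (suc k)) (qbinom (suc n) (suc k)) (q^ (suc k)) (qbinom n k) (qbinom n (suc k))))
    where
    N = qint (suc n)

  -- Complementary absorption:  [N+1-j] [N+1 | j] = [N+1] [N | j],  written with N = m + j.
  -- Multiplied by q^j it is qbinom-difference, since [N+1] - [j] = q^j [N+1-j].
  qbinom-complement : ∀ m j → qint (suc m) ⊠ qbinom (suc m ℕ.+ j) j ≃ qint (suc m ℕ.+ j) ⊠ qbinom (m ℕ.+ j) j
  qbinom-complement m j = q^-cancel j
    (using-difference 𝟏 (qbinom-difference (m ℕ.+ j) j)
      (using-difference (κ (ℤ.- 1ℤ) ⊠ Bx) S≃[j]+q^j[m+1]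
        (solve 6 (λ qj M S Kj Bx By →
           qj :* (M :* Bx)
           := qj :* (S :* By)
              :+ con 1ℤ :* ((S :- Kj) :* Bx :- qj :* S :* By)
              :+ con (ℤ.- 1ℤ) :* Bx :* (S :- (Kj :+ qj :* M)))
           ≃-refl (q^ j) (qint (suc m)) S (qint j) Bx (qbinom (m ℕ.+ j) j))))
    where
    S = qint (suc (m ℕ.+ j))
    Bx = qbinom (suc m ℕ.+ j) j
    S≃[j]+q^j[m+1] : S ≃ qint j ⊞ q^ j ⊠ qint (suc m)
    S≃[j]+q^j[m+1] = ≃-trans (≡⇒≃ (cong qint (≡.trans (cong suc (ℕP.+-comm m j)) (≡.sym (ℕP.+-suc j m)))))
                              (qint-+ j (suc m))

  qbinom-lower : ∀ m j → (𝟏 ⊟ q^ (suc m)) ⊠ qbinom (suc m ℕ.+ j) j ≃ (𝟏 ⊟ q^ (suc m ℕ.+ j)) ⊠ qbinom (m ℕ.+ j) j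
  qbinom-lower m j = qint-identity-times-1-q (suc m) (suc m ℕ.+ j) (qbinom-complement m j)

module Summand where

  open LaurentPolynomials using (κ)
  open LaurentRing
  open SumsAndPowers
  open QAnalogues
  open import Data.Nat as ℕ using (ℕ; suc; _∸_)
  import Data.Nat.Properties as ℕP
  import Data.Nat.Tactic.RingSolver as ℕ-Solver
  open import Data.Integer as ℤ using (+_; 0ℤ; 1ℤ)
  import Data.Integer.Properties as ℤP
  import Data.Integer.Tactic.RingSolver as ℤ-Solver
  open import Data.List.Properties using (map-upTo)
  open import Relation.Binary.PropositionalEquality as ≡ using (_≡_; refl; cong; cong₂)

  -- T(n,s,k) = weight n k · poch s k: only the first factor depends on n, only the second on s.
  weight : ℕ → ℕ → Laurent
  weight n k = q^ (n ∸ k) ⊠ qint (suc (2 ℕ.* k)) ⊠ qbinom (suc (2 ℕ.* n)) (n ∸ k)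

  poch : ℕ → ℕ → Laurent
  poch s k = qPoch (ℤ.- (+ k)) s ⊠ qPoch (+ (k ℕ.+ 1)) s

  term-factor : ∀ n s k → term n s k ≃ weight n k ⊠ poch s k
  term-factor n s k = begin
    term n s k
      ≈⟨ ≃-trans (*L≃⊠ _ _) (*-cong (≃-trans (*L≃⊠ _ _) (*-cong (≃-trans (*L≃⊠ _ _) (*-cong (*L≃⊠ _ _) ≃-refl)) ≃-refl)) ≃-refl) ⟩
    q^ (n ∸ k) ⊠ qint (2 ℕ.* k ℕ.+ 1) ⊠ qbinom (2 ℕ.* n ℕ.+ 1) (n ∸ k) ⊠ P₁ ⊠ P₂
      ≈⟨ ≡⇒≃ (cong₂ (λ a b → q^ (n ∸ k) ⊠ qint a ⊠ qbinom b (n ∸ k) ⊠ P₁ ⊠ P₂) (ℕP.+-comm (2 ℕ.* k) 1) (ℕP.+-comm (2 ℕ.* n) 1)) ⟩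
    weight n k ⊠ P₁ ⊠ P₂
      ≈⟨ solve 3 (λ w x y → w :* x :* y := w :* (x :* y)) ≃-refl (weight n k) P₁ P₂ ⟩
    weight n k ⊠ poch s k ∎
    where
    P₁ = qPoch (ℤ.- (+ k)) s
    P₂ = qPoch (+ (k ℕ.+ 1)) s

  qPoch-suc : ∀ c s → qPoch c (suc s) ≃ qPoch c s ⊠ (𝟏 ⊟ qpow (c ℤ.+ + s))
  qPoch-suc c s = begin
    qPoch c (suc s)                  ≈⟨ ≡⇒≃ (cong prodL (map-upTo factor (suc s))) ⟩
    prodUpTo factor (suc s)          ≈⟨ prodUpTo-snoc factor s ⟩
    prodUpTo factor s ⊠ factor s     ≈⟨ *-cong (≡⇒≃ (cong prodL (≡.sym (map-upTo factor s)))) (-L≃⊟ oneL (qpow (c ℤ.+ + s))) ⟩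
    qPoch c s ⊠ (𝟏 ⊟ qpow (c ℤ.+ + s)) ∎
    where factor = λ i → oneL -L qpow (c ℤ.+ + i)

  G : ℕ → ℕ → Laurent
  G s k = (𝟏 ⊟ qpow (ℤ.- (+ k) ℤ.+ + s)) ⊠ (𝟏 ⊟ qpow (+ (k ℕ.+ 1) ℤ.+ + s))

  poch-suc : ∀ s k → poch (suc s) k ≃ poch s k ⊠ G s k
  poch-suc s k = begin
    poch (suc s) k                  ≈⟨ *-cong (qPoch-suc (ℤ.- (+ k)) s) (qPoch-suc (+ (k ℕ.+ 1)) s) ⟩
    P₁ ⊠ g₁ ⊠ (P₂ ⊠ g₂)             ≈⟨ solve 4 (λ a b c d → a :* b :* (c :* d) := a :* c :* (b :* d)) ≃-refl P₁ g₁ P₂ g₂ ⟩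
    poch s k ⊠ G s k                ∎
    where
    P₁ = qPoch (ℤ.- (+ k)) s
    P₂ = qPoch (+ (k ℕ.+ 1)) s
    g₁ = 𝟏 ⊟ qpow (ℤ.- (+ k) ℤ.+ + s)
    g₂ = 𝟏 ⊟ qpow (+ (k ℕ.+ 1) ℤ.+ + s)

  A : ℕ → ℕ → Laurent
  A n x = (𝟏 ⊟ qpow (+ n ℤ.- + x)) ⊠ (𝟏 ⊟ qpow (+ n ℤ.+ + x ℤ.+ 1ℤ))

  -- G s k = q^{s-n} (A_n(k) - A_n(s)) for every n: both sides expand to
  -- 1 - q^{s-k} - q^{s+k+1} + q^{2s+1}, using only q^x q^y = q^{x+y}.
  G-factorisation : ∀ n s k → G s k ≃ qpow (+ s ℤ.- + n) ⊠ (A n k ⊟ A n s)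
  G-factorisation n s k = ≃-sym
    (using-difference (c ⊟ 𝟏) (qpow-+≡ _ _ _ (exponent₁ (+ s) (+ n) (+ k)))
      (using-difference (κ (ℤ.- 1ℤ)) (qpow-+≡ _ _ _ (exponent₂ (+ s) (+ n) (+ k)))
        (using-difference (𝟏 ⊟ e) (qpow-+≡ _ _ _ (exponent₃ (+ s) (+ n)))
          (using-difference (κ (ℤ.- 1ℤ)) (≃-trans (qpow-+≡ _ _ _ (exponent₄ (+ s) (+ n) (+ k))) (≃-sym (qpow-+ _ _)))
            (using-difference 𝟏 (qpow-+≡ _ _ _ (exponent₅ (+ s) (+ n) (+ k)))
              (solve 7 (λ a b c d e f g →
                 a :* ((con 1ℤ :- b) :* (con 1ℤ :- c) :- (con 1ℤ :- d) :* (con 1ℤ :- e))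
                 := (con 1ℤ :- f) :* (con 1ℤ :- g)
                    :+ (c :- con 1ℤ) :* (a :* b :- f)
                    :+ con (ℤ.- 1ℤ) :* (a :* c :- g)
                    :+ (con 1ℤ :- e) :* (a :* d :- con 1ℤ)
                    :+ con (ℤ.- 1ℤ) :* (f :* g :- a :* e)
                    :+ con 1ℤ :* (f :* c :- e))
                 ≃-refl a b c d e f g))))))
    where
    a = qpow (+ s ℤ.- + n)
    b = qpow (+ n ℤ.- + k)
    c = qpow (+ n ℤ.+ + k ℤ.+ 1ℤ)
    d = qpow (+ n ℤ.- + s)
    e = qpow (+ n ℤ.+ + s ℤ.+ 1ℤ)
    f = qpow (ℤ.- (+ k) ℤ.+ + s)
    g = qpow (+ (k ℕ.+ 1) ℤ.+ + s)
    exponent₁ : ∀ s n k → (s ℤ.- n) ℤ.+ (n ℤ.- k) ≡ ℤ.- k ℤ.+ s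
    exponent₁ = ℤ-Solver.solve-∀
    exponent₂ : ∀ s n k → (s ℤ.- n) ℤ.+ (n ℤ.+ k ℤ.+ 1ℤ) ≡ k ℤ.+ 1ℤ ℤ.+ s
    exponent₂ = ℤ-Solver.solve-∀
    exponent₃ : ∀ s n → (s ℤ.- n) ℤ.+ (n ℤ.- s) ≡ 0ℤ
    exponent₃ = ℤ-Solver.solve-∀
    exponent₄ : ∀ s n k → (ℤ.- k ℤ.+ s) ℤ.+ (k ℤ.+ 1ℤ ℤ.+ s) ≡ (s ℤ.- n) ℤ.+ (n ℤ.+ s ℤ.+ 1ℤ)
    exponent₄ = ℤ-Solver.solve-∀
    exponent₅ : ∀ s n k → (ℤ.- k ℤ.+ s) ℤ.+ (n ℤ.+ k ℤ.+ 1ℤ) ≡ n ℤ.+ s ℤ.+ 1ℤ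
    exponent₅ = ℤ-Solver.solve-∀

  term-suc : ∀ n s k → term n (suc s) k ≃ qpow (+ s ℤ.- + n) ⊠ (term n s k ⊠ A n k ⊟ A n s ⊠ term n s k)
  term-suc n s k = begin
    term n (suc s) k                                ≈⟨ term-factor n (suc s) k ⟩
    w ⊠ poch (suc s) k                              ≈⟨ *-cong ≃-refl (poch-suc s k) ⟩
    w ⊠ (p ⊠ G s k)                                 ≈⟨ *-cong ≃-refl (*-cong ≃-refl (G-factorisation n s k)) ⟩
    w ⊠ (p ⊠ (α ⊠ (A n k ⊟ A n s)))                 ≈⟨ solve 5 (λ w p α x y → w :* (p :* (α :* (x :- y))) := α :* (w :* p :* x :- y :* (w :* p))) ≃-refl w p α (A n k) (A n s) ⟩
    α ⊠ (w ⊠ p ⊠ A n k ⊟ A n s ⊠ (w ⊠ p))           ≈⟨ *-cong ≃-refl (+-cong (*-cong (≃-sym (term-factor n s k)) ≃-refl) (-‿cong (*-cong ≃-refl (≃-sym (term-factor n s k))))) ⟩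
    α ⊠ (term n s k ⊠ A n k ⊟ A n s ⊠ term n s k)   ∎
    where
    w = weight n k
    p = poch s k
    α = qpow (+ s ℤ.- + n)

  -- A_n(n) = 0, so the top summand drops out of Σ_k T(n,s,k) A_n(k).
  A-diagonal : ∀ n → A n n ≃ 𝟎
  A-diagonal n = begin
    A n n                      ≈⟨ *-cong (+-cong ≃-refl (-‿cong (qpow-cong (ℤP.+-inverseʳ (+ n))))) ≃-refl ⟩
    (𝟏 ⊟ 𝟏) ⊠ (𝟏 ⊟ x)          ≈⟨ solve 1 (λ x → (con 1ℤ :- con 1ℤ) :* (con 1ℤ :- x) := con 0ℤ) ≃-refl x ⟩
    𝟎                          ∎
    where x = qpow (+ n ℤ.+ + n ℤ.+ 1ℤ)

  C : ℕ → Laurent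
  C n = q^ 1 ⊠ (𝟏 ⊟ q^ (suc (2 ℕ.* n))) ⊠ (𝟏 ⊟ q^ (2 ℕ.* n))

  weight-shift : ∀ k i → weight (suc (k ℕ.+ i)) k ⊠ A (suc (k ℕ.+ i)) k ≃ C (suc (k ℕ.+ i)) ⊠ weight (k ℕ.+ i) k
  weight-shift k i = begin
    weight n k ⊠ A n k                              ≈⟨ *-cong (≡⇒≃ (cong (λ d → q^ d ⊠ K ⊠ qbinom (suc (2 ℕ.* n)) d) n∸k≡1+i)) A-form ⟩
    u ⊠ K ⊠ B₁ ⊠ ((𝟏 ⊟ u) ⊠ (𝟏 ⊟ v))                ≈⟨ solve 4 (λ u K B v → u :* K :* B :* ((con 1ℤ :- u) :* (con 1ℤ :- v)) := u :* K :* (con 1ℤ :- v) :* ((con 1ℤ :- u) :* B)) ≃-refl u K B₁ v ⟩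
    u ⊠ K ⊠ (𝟏 ⊟ v) ⊠ ((𝟏 ⊟ u) ⊠ B₁)                ≈⟨ *-cong ≃-refl (qbinom-absorption′ (2 ℕ.* n) i) ⟩
    u ⊠ K ⊠ (𝟏 ⊟ v) ⊠ ((𝟏 ⊟ w₁) ⊠ B₂)               ≈⟨ solve 5 (λ u K v w B → u :* K :* (con 1ℤ :- v) :* ((con 1ℤ :- w) :* B) := u :* K :* (con 1ℤ :- w) :* ((con 1ℤ :- v) :* B)) ≃-refl u K v w₁ B₂ ⟩
    u ⊠ K ⊠ (𝟏 ⊟ w₁) ⊠ ((𝟏 ⊟ v) ⊠ B₂)               ≈⟨ *-cong (*-cong (*-cong (q^-suc i) ≃-refl) ≃-refl) lower ⟩
    q ⊠ qi ⊠ K ⊠ (𝟏 ⊟ w₁) ⊠ ((𝟏 ⊟ w₂) ⊠ B₃)         ≈⟨ solve 6 (λ q qi K w₁ w₂ B → q :* qi :* K :* (con 1ℤ :- w₁) :* ((con 1ℤ :- w₂) :* B) := q :* (con 1ℤ :- w₁) :* (con 1ℤ :- w₂) :* (qi :* K :* B)) ≃-refl q qi K w₁ w₂ B₃ ⟩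
    C n ⊠ (qi ⊠ K ⊠ B₃)                             ≈⟨ *-cong ≃-refl (≡⇒≃ (cong (λ d → q^ d ⊠ K ⊠ qbinom (suc (2 ℕ.* n′)) d) (≡.sym (ℕP.m+n∸m≡n k i)))) ⟩
    C n ⊠ weight n′ k                               ∎
    where
    n′ = k ℕ.+ i
    n = suc n′
    q = q^ 1
    qi = q^ i
    u = q^ (suc i)
    v = q^ (suc (n ℕ.+ k))
    w₁ = q^ (suc (2 ℕ.* n))
    w₂ = q^ (2 ℕ.* n)
    K = qint (suc (2 ℕ.* k))
    B₁ = qbinom (suc (2 ℕ.* n)) (suc i)
    B₂ = qbinom (2 ℕ.* n) i
    B₃ = qbinom (suc (2 ℕ.* n′)) i
    n∸k≡1+i : n ∸ k ≡ suc i
    n∸k≡1+i = ≡.trans (cong (_∸ k) (≡.sym (ℕP.+-suc k i))) (ℕP.m+n∸m≡n k (suc i))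
    n-k≡1+i : + n ℤ.- + k ≡ + suc i
    n-k≡1+i = difference (+ k) (+ i)
      where
      difference : ∀ k i → (1ℤ ℤ.+ (k ℤ.+ i)) ℤ.- k ≡ 1ℤ ℤ.+ i
      difference = ℤ-Solver.solve-∀
    A-form : A n k ≃ (𝟏 ⊟ u) ⊠ (𝟏 ⊟ v)
    A-form = *-cong (+-cong ≃-refl (-‿cong (qpow-cong n-k≡1+i)))
                    (+-cong ≃-refl (-‿cong (qpow-cong (cong +_ (ℕP.+-comm (n ℕ.+ k) 1)))))
    2n≡ : ∀ k i → suc (suc (k ℕ.+ i) ℕ.+ k) ℕ.+ i ≡ 2 ℕ.* suc (k ℕ.+ i)
    2n≡ = ℕ-Solver.solve-∀
    2n′+1≡ : ∀ k i → (suc (k ℕ.+ i) ℕ.+ k) ℕ.+ i ≡ suc (2 ℕ.* (k ℕ.+ i))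
    2n′+1≡ = ℕ-Solver.solve-∀
    -- (1 - q^{n+k+1}) [2n | i] = (1 - q^{2n}) [2n-1 | i], as 2n - i = n + k + 1.
    lower : (𝟏 ⊟ v) ⊠ B₂ ≃ (𝟏 ⊟ w₂) ⊠ B₃
    lower = ≃-trans (*-cong ≃-refl (≡⇒≃ (cong (λ t → qbinom t i) (≡.sym (2n≡ k i)))))
              (≃-trans (qbinom-lower (n ℕ.+ k) i)
                (≡⇒≃ (cong₂ (λ t b → (𝟏 ⊟ q^ t) ⊠ qbinom b i) (2n≡ k i) (2n′+1≡ k i))))

  -- The same recursion in n for the summands themselves (the Pochhammer factors are unaffected).
  term-shift : ∀ {n} k s → k ℕ.≤ n → term (suc n) s k ⊠ A (suc n) k ≃ C (suc n) ⊠ term n s k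
  term-shift {n} k s k≤n =
    ≡.subst (λ N → term (suc N) s k ⊠ A (suc N) k ≃ C (suc N) ⊠ term N s k) (ℕP.m+[n∸m]≡n k≤n) (shifted (n ∸ k))
    where
    shifted : ∀ i → term (suc (k ℕ.+ i)) s k ⊠ A (suc (k ℕ.+ i)) k ≃ C (suc (k ℕ.+ i)) ⊠ term (k ℕ.+ i) s k
    shifted i = begin
      term N s k ⊠ A N k                  ≈⟨ *-cong (term-factor N s k) ≃-refl ⟩
      weight N k ⊠ poch s k ⊠ A N k       ≈⟨ solve 3 (λ w p a → w :* p :* a := w :* a :* p) ≃-refl (weight N k) (poch s k) (A N k) ⟩
      weight N k ⊠ A N k ⊠ poch s k       ≈⟨ *-cong (weight-shift k i) ≃-refl ⟩
      C N ⊠ weight N′ k ⊠ poch s k        ≈⟨ solve 3 (λ c w p → c :* w :* p := c :* (w :* p)) ≃-refl (C N) (weight N′ k) (poch s k) ⟩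
      C N ⊠ (weight N′ k ⊠ poch s k)      ≈⟨ *-cong ≃-refl (≃-sym (term-factor N′ s k)) ⟩
      C N ⊠ term N′ s k                   ∎
      where
      N′ = k ℕ.+ i
      N = suc N′

  top-vanishes : ∀ n s k → k ≡ n → term n s k ⊠ A n k ≃ 𝟎
  top-vanishes n s .n refl = begin
    term n s n ⊠ A n n   ≈⟨ *-cong ≃-refl (A-diagonal n) ⟩
    term n s n ⊠ 𝟎       ≈⟨ solve 1 (λ t → t :* con 0ℤ := con 0ℤ) ≃-refl (term n s n) ⟩
    𝟎                    ∎

  M : ℕ → ℕ → Laurent
  M n a = qint (suc (2 ℕ.* n)) ⊠ qbinom (2 ℕ.* n) (n ∸ a)

  modulus≃M : ∀ n a → modulus n a ≃ M n a
  modulus≃M n a = ≃-trans (*L≃⊠ _ _) (≡⇒≃ (cong (λ t → qint t ⊠ qbinom (2 ℕ.* n) (n ∸ a)) (ℕP.+-comm (2 ℕ.* n) 1)))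

  M-at : ∀ m a → M (m ℕ.+ a) a ≡ qint (suc (2 ℕ.* (m ℕ.+ a))) ⊠ qbinom (2 ℕ.* (m ℕ.+ a)) m
  M-at m a = cong (λ d → qint (suc (2 ℕ.* (m ℕ.+ a))) ⊠ qbinom (2 ℕ.* (m ℕ.+ a)) d) (ℕP.m+n∸n≡m m a)

  modulus-shift : ∀ m a → C (suc (m ℕ.+ a)) ⊠ M (m ℕ.+ a) a
                          ≃ M (suc (m ℕ.+ a)) a ⊠ (q^ 1 ⊠ (𝟏 ⊟ q^ (suc m)) ⊠ (𝟏 ⊟ q^ (suc (m ℕ.+ a ℕ.+ a))))
  modulus-shift m a = begin
    C n ⊠ M n′ a                                           ≈⟨ *-cong ≃-refl (≡⇒≃ (M-at m a)) ⟩
    q ⊠ (𝟏 ⊟ w₁) ⊠ (𝟏 ⊟ w₂) ⊠ (N₃ ⊠ B₄)                    ≈⟨ *-cong (*-cong (*-cong ≃-refl (≃-sym (qint-times-1-q (suc (2 ℕ.* n))))) ≃-refl) ≃-refl ⟩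
    q ⊠ ((𝟏 ⊟ q) ⊠ N₁) ⊠ (𝟏 ⊟ w₂) ⊠ (N₃ ⊠ B₄)              ≈⟨ solve 5 (λ q N₁ w₂ N₃ B₄ → q :* ((con 1ℤ :- q) :* N₁) :* (con 1ℤ :- w₂) :* (N₃ :* B₄) := q :* N₁ :* (con 1ℤ :- w₂) :* ((con 1ℤ :- q) :* N₃ :* B₄)) ≃-refl q N₁ w₂ N₃ B₄ ⟩
    q ⊠ N₁ ⊠ (𝟏 ⊟ w₂) ⊠ ((𝟏 ⊟ q) ⊠ N₃ ⊠ B₄)                ≈⟨ *-cong ≃-refl (≃-trans (*-cong (qint-times-1-q (suc (2 ℕ.* n′))) ≃-refl) (≃-sym lower)) ⟩
    q ⊠ N₁ ⊠ (𝟏 ⊟ w₂) ⊠ ((𝟏 ⊟ x₂) ⊠ B₃)                    ≈⟨ solve 5 (λ q N₁ w₂ x₂ B₃ → q :* N₁ :* (con 1ℤ :- w₂) :* ((con 1ℤ :- x₂) :* B₃) := q :* N₁ :* (con 1ℤ :- x₂) :* ((con 1ℤ :- w₂) :* B₃)) ≃-refl q N₁ w₂ x₂ B₃ ⟩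
    q ⊠ N₁ ⊠ (𝟏 ⊟ x₂) ⊠ ((𝟏 ⊟ w₂) ⊠ B₃)                    ≈⟨ *-cong ≃-refl (≃-sym absorption) ⟩
    q ⊠ N₁ ⊠ (𝟏 ⊟ x₂) ⊠ ((𝟏 ⊟ x₁) ⊠ B₂)                    ≈⟨ solve 5 (λ q N₁ x₂ x₁ B₂ → q :* N₁ :* (con 1ℤ :- x₂) :* ((con 1ℤ :- x₁) :* B₂) := N₁ :* B₂ :* (q :* (con 1ℤ :- x₁) :* (con 1ℤ :- x₂))) ≃-refl q N₁ x₂ x₁ B₂ ⟩
    N₁ ⊠ B₂ ⊠ (q ⊠ (𝟏 ⊟ x₁) ⊠ (𝟏 ⊟ x₂))                    ≈⟨ *-cong (≡⇒≃ (≡.sym (M-at (suc m) a))) ≃-refl ⟩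
    M n a ⊠ (q ⊠ (𝟏 ⊟ x₁) ⊠ (𝟏 ⊟ x₂))                      ∎
    where
    n′ = m ℕ.+ a
    n = suc n′
    q = q^ 1
    w₁ = q^ (suc (2 ℕ.* n))
    w₂ = q^ (2 ℕ.* n)
    x₁ = q^ (suc m)
    x₂ = q^ (suc (n′ ℕ.+ a))
    N₁ = qint (suc (2 ℕ.* n))
    N₃ = qint (suc (2 ℕ.* n′))
    B₂ = qbinom (2 ℕ.* n) (suc m)
    B₃ = qbinom (suc (2 ℕ.* n′)) m
    B₄ = qbinom (2 ℕ.* n′) m
    2n≡ : 2 ℕ.* n ≡ suc (suc (2 ℕ.* n′))
    2n≡ = ℕP.*-suc 2 n′
    absorption : (𝟏 ⊟ x₁) ⊠ B₂ ≃ (𝟏 ⊟ w₂) ⊠ B₃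
    absorption = ≃-trans (*-cong ≃-refl (≡⇒≃ (cong (λ t → qbinom t (suc m)) 2n≡)))
                   (≃-trans (qbinom-absorption′ (suc (2 ℕ.* n′)) m)
                     (*-cong (+-cong ≃-refl (-‿cong (≡⇒≃ (cong q^_ (≡.sym 2n≡))))) ≃-refl))
    2n′+1≡ : ∀ m a → suc (m ℕ.+ a ℕ.+ a) ℕ.+ m ≡ suc (2 ℕ.* (m ℕ.+ a))
    2n′+1≡ = ℕ-Solver.solve-∀
    2n′≡ : ∀ m a → m ℕ.+ a ℕ.+ a ℕ.+ m ≡ 2 ℕ.* (m ℕ.+ a)
    2n′≡ = ℕ-Solver.solve-∀
    -- (1 - q^{n'+a+1}) [2n'+1 | m] = (1 - q^{2n'+1}) [2n' | m], as 2n'+1-m = n'+a+1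
    lower : (𝟏 ⊟ x₂) ⊠ B₃ ≃ (𝟏 ⊟ q^ (suc (2 ℕ.* n′))) ⊠ B₄
    lower = ≃-trans (*-cong ≃-refl (≡⇒≃ (cong (λ t → qbinom t m) (≡.sym (2n′+1≡ m a)))))
              (≃-trans (qbinom-lower (n′ ℕ.+ a) m)
                (≡⇒≃ (cong₂ (λ t b → (𝟏 ⊟ q^ t) ⊠ qbinom b m) (2n′+1≡ m a) (2n′≡ m a))))

  telescope : ∀ j a →
    q^ (suc j) ⊠ qint (suc (2 ℕ.* a)) ⊠ qbinom (suc (2 ℕ.* (suc j ℕ.+ a))) (suc j)
      ⊞ qint (suc (2 ℕ.* (suc j ℕ.+ a))) ⊠ qbinom (2 ℕ.* (suc j ℕ.+ a)) j
    ≃ qint (suc (2 ℕ.* (suc j ℕ.+ a))) ⊠ qbinom (2 ℕ.* (suc j ℕ.+ a)) (suc j)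
  telescope j a = begin
    u ⊠ [2a+1] ⊠ B ⊞ N ⊠ qbinom (2 ℕ.* n) j     ≈⟨ +-cong ≃-refl (≃-sym (qbinom-absorption (2 ℕ.* n) j)) ⟩
    u ⊠ [2a+1] ⊠ B ⊞ K ⊠ B                      ≈⟨ solve 4 (λ u A B K → u :* A :* B :+ K :* B := (K :+ u :* A) :* B) ≃-refl u [2a+1] B K ⟩
    (K ⊞ u ⊠ [2a+1]) ⊠ B                        ≈⟨ *-cong (≃-sym (qint-+ (suc j) (suc (2 ℕ.* a)))) ≃-refl ⟩
    qint (suc j ℕ.+ suc (2 ℕ.* a)) ⊠ B          ≈⟨ complement ⟩
    N ⊠ qbinom (2 ℕ.* n) (suc j)                ∎
    where
    n = suc j ℕ.+ a
    u = q^ (suc j)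
    K = qint (suc j)
    N = qint (suc (2 ℕ.* n))
    [2a+1] = qint (suc (2 ℕ.* a))
    B = qbinom (suc (2 ℕ.* n)) (suc j)
    2n+1≡ : ∀ j a → suc (j ℕ.+ suc (2 ℕ.* a)) ℕ.+ suc j ≡ suc (2 ℕ.* (suc j ℕ.+ a))
    2n+1≡ = ℕ-Solver.solve-∀
    2n≡ : ∀ j a → j ℕ.+ suc (2 ℕ.* a) ℕ.+ suc j ≡ 2 ℕ.* (suc j ℕ.+ a)
    2n≡ = ℕ-Solver.solve-∀
    -- [2n-j] [2n+1 | j+1] = [2n+1] [2n | j+1], as 2n - j = (j+1) + (2a+1)
    complement : qint (suc j ℕ.+ suc (2 ℕ.* a)) ⊠ B ≃ N ⊠ qbinom (2 ℕ.* n) (suc j)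
    complement = ≃-trans (*-cong ≃-refl (≡⇒≃ (cong (λ t → qbinom t (suc j)) (≡.sym (2n+1≡ j a)))))
                   (≃-trans (qbinom-complement (j ℕ.+ suc (2 ℕ.* a)) (suc j))
                     (≡⇒≃ (cong₂ (λ t b → qint t ⊠ qbinom b (suc j)) (2n+1≡ j a) (2n≡ j a))))

module Induction where

  open LaurentRing
  open SumsAndPowers
  open QAnalogues
  open Summand
  open import Data.Nat as ℕ using (ℕ; zero; suc; _∸_)
  import Data.Nat.Properties as ℕP
  open import Data.Integer as ℤ using (+_; 0ℤ; 1ℤ)
  open import Data.List.Properties using (map-upTo)
  open import Data.Product using (Σ; _,_)
  open import Relation.Binary.PropositionalEquality as ≡ using (_≡_; cong)

  partial : ℕ → ℕ → ℕ → ℕ → Laurent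
  partial n s a m = sumUpTo (λ j → term n s (a ℕ.+ j)) (suc m)

  lhs≡partial : ∀ n a s → lhs n a s ≡ partial n s a (n ∸ a)
  lhs≡partial n a s = cong sumL (map-upTo (λ j → term n s (a ℕ.+ j)) (suc (n ∸ a)))

  weighted : ℕ → ℕ → ℕ → ℕ → Laurent
  weighted n s a m = sumUpTo (λ j → term n s (a ℕ.+ j) ⊠ A n (a ℕ.+ j)) (suc m)

  partial-suc : ∀ n s a m → partial n (suc s) a m ≃ qpow (+ s ℤ.- + n) ⊠ (weighted n s a m ⊟ A n s ⊠ partial n s a m)
  partial-suc n s a m = begin
    partial n (suc s) a m                                         ≈⟨ sumUpTo-cong (suc m) (λ j _ → term-suc n s (a ℕ.+ j)) ⟩
    sumUpTo (λ j → α ⊠ (t j ⊠ A n (a ℕ.+ j) ⊟ A n s ⊠ t j)) (suc m) ≈⟨ sumUpTo-scale α (λ j → t j ⊠ A n (a ℕ.+ j) ⊟ A n s ⊠ t j) (suc m) ⟩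
    α ⊠ sumUpTo (λ j → t j ⊠ A n (a ℕ.+ j) ⊟ A n s ⊠ t j) (suc m)   ≈⟨ *-cong ≃-refl (sumUpTo-sub (λ j → t j ⊠ A n (a ℕ.+ j)) (λ j → A n s ⊠ t j) (suc m)) ⟩
    α ⊠ (weighted n s a m ⊟ sumUpTo (λ j → A n s ⊠ t j) (suc m))  ≈⟨ *-cong ≃-refl (+-cong ≃-refl (-‿cong (sumUpTo-scale (A n s) t (suc m)))) ⟩
    α ⊠ (weighted n s a m ⊟ A n s ⊠ partial n s a m)               ∎
    where
    α = qpow (+ s ℤ.- + n)
    t = λ j → term n s (a ℕ.+ j)

  weighted-top : ∀ s a → weighted a s a 0 ≃ 𝟎
  weighted-top s a = ≃-trans (sumUpTo-single (λ j → term a s (a ℕ.+ j) ⊠ A a (a ℕ.+ j))) (top-vanishes a s (a ℕ.+ 0) (ℕP.+-identityʳ a))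

  weighted-shift : ∀ s m a → weighted (suc m ℕ.+ a) s a (suc m) ≃ C (suc m ℕ.+ a) ⊠ partial (m ℕ.+ a) s a m
  weighted-shift s m a = begin
    weighted n s a (suc m)                                  ≈⟨ sumUpTo-snoc f (suc m) ⟩
    sumUpTo f (suc m) ⊞ f (suc m)                           ≈⟨ +-cong (sumUpTo-cong (suc m) shifted) (top-vanishes n s (a ℕ.+ suc m) a+1+m≡n) ⟩
    sumUpTo (λ j → C n ⊠ term n′ s (a ℕ.+ j)) (suc m) ⊞ 𝟎   ≈⟨ +-cong (sumUpTo-scale (C n) (λ j → term n′ s (a ℕ.+ j)) (suc m)) ≃-refl ⟩
    C n ⊠ partial n′ s a m ⊞ 𝟎                              ≈⟨ solve 1 (λ x → x :+ con 0ℤ := x) ≃-refl (C n ⊠ partial n′ s a m) ⟩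
    C n ⊠ partial n′ s a m                                  ∎
    where
    n′ = m ℕ.+ a
    n = suc n′
    f = λ j → term n s (a ℕ.+ j) ⊠ A n (a ℕ.+ j)
    a+1+m≡n : a ℕ.+ suc m ≡ n
    a+1+m≡n = ≡.trans (ℕP.+-suc a m) (cong suc (ℕP.+-comm a m))
    shifted : ∀ j → j ℕ.< suc m → f j ≃ C n ⊠ term n′ s (a ℕ.+ j)
    shifted j j<1+m = term-shift (a ℕ.+ j) s
      (ℕP.≤-trans (ℕP.+-monoʳ-≤ a (ℕ.s≤s⁻¹ j<1+m)) (ℕP.≤-reflexive (ℕP.+-comm a m)))

  -- The summand with k = a at s = 0, where both Pochhammer symbols are 1.
  first-summand : ∀ m a → term (m ℕ.+ a) 0 (a ℕ.+ 0) ≃ q^ m ⊠ qint (suc (2 ℕ.* a)) ⊠ qbinom (suc (2 ℕ.* (m ℕ.+ a))) m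
  first-summand m a = begin
    term n 0 (a ℕ.+ 0)         ≈⟨ ≡⇒≃ (cong (term n 0) (ℕP.+-identityʳ a)) ⟩
    term n 0 a                 ≈⟨ term-factor n 0 a ⟩
    weight n a ⊠ (𝟏 ⊠ 𝟏)       ≈⟨ solve 1 (λ w → w :* (con 1ℤ :* con 1ℤ) := w) ≃-refl (weight n a) ⟩
    weight n a                 ≈⟨ ≡⇒≃ (cong (λ d → q^ d ⊠ qint (suc (2 ℕ.* a)) ⊠ qbinom (suc (2 ℕ.* n)) d) (ℕP.m+n∸n≡m m a)) ⟩
    q^ m ⊠ qint (suc (2 ℕ.* a)) ⊠ qbinom (suc (2 ℕ.* n)) m ∎
    where n = m ℕ.+ a

  partial-at-zero : ∀ m a → partial (m ℕ.+ a) 0 a m ≃ M (m ℕ.+ a) a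
  partial-at-zero zero a = begin
    partial a 0 a 0                 ≈⟨ sumUpTo-single (λ j → term a 0 (a ℕ.+ j)) ⟩
    term a 0 (a ℕ.+ 0)              ≈⟨ first-summand 0 a ⟩
    𝟏 ⊠ N ⊠ 𝟏                       ≈⟨ solve 1 (λ x → con 1ℤ :* x :* con 1ℤ := x :* con 1ℤ) ≃-refl N ⟩
    N ⊠ 𝟏                           ≈⟨ ≡⇒≃ (≡.sym (M-at 0 a)) ⟩
    M a a                           ∎
    where N = qint (suc (2 ℕ.* a))
  partial-at-zero (suc m) a = begin
    partial n 0 a (suc m)                                                  ≈⟨ sumUpTo-suc (λ j → term n 0 (a ℕ.+ j)) (suc m) ⟩
    term n 0 (a ℕ.+ 0) ⊞ sumUpTo (λ j → term n 0 (a ℕ.+ suc j)) (suc m)     ≈⟨ +-cong (first-summand (suc m) a) rest ⟩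
    q^ (suc m) ⊠ qint (suc (2 ℕ.* a)) ⊠ qbinom (suc (2 ℕ.* n)) (suc m)
      ⊞ qint (suc (2 ℕ.* n)) ⊠ qbinom (2 ℕ.* n) m                          ≈⟨ telescope m a ⟩
    qint (suc (2 ℕ.* n)) ⊠ qbinom (2 ℕ.* n) (suc m)                        ≈⟨ ≡⇒≃ (≡.sym (M-at (suc m) a)) ⟩
    M n a                                                                  ∎
    where
    n = suc m ℕ.+ a
    m+1+a≡n : m ℕ.+ suc a ≡ n
    m+1+a≡n = ℕP.+-suc m a
    -- the remaining summands form the sum for a+1, which telescopes by induction
    rest : sumUpTo (λ j → term n 0 (a ℕ.+ suc j)) (suc m) ≃ qint (suc (2 ℕ.* n)) ⊠ qbinom (2 ℕ.* n) m
    rest = begin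
      sumUpTo (λ j → term n 0 (a ℕ.+ suc j)) (suc m)          ≈⟨ sumUpTo-cong (suc m) (λ j _ → ≡⇒≃ (cong (term n 0) (ℕP.+-suc a j))) ⟩
      partial n 0 (suc a) m                                  ≈⟨ ≡⇒≃ (cong (λ N → partial N 0 (suc a) m) (≡.sym m+1+a≡n)) ⟩
      partial (m ℕ.+ suc a) 0 (suc a) m                      ≈⟨ partial-at-zero m (suc a) ⟩
      M (m ℕ.+ suc a) (suc a)                                ≈⟨ ≡⇒≃ (≡.trans (M-at m (suc a)) (cong (λ N → qint (suc (2 ℕ.* N)) ⊠ qbinom (2 ℕ.* N) m) m+1+a≡n)) ⟩
      qint (suc (2 ℕ.* n)) ⊠ qbinom (2 ℕ.* n) m              ∎

  infix 4 _∣_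
  _∣_ : Laurent → Laurent → Set
  D ∣ X = Σ Laurent λ R → X ≃ D ⊠ R

  ∣-resp : ∀ {D X Y} → X ≃ Y → D ∣ X → D ∣ Y
  ∣-resp X≃Y (R , X≃DR) = R , ≃-trans (≃-sym X≃Y) X≃DR

  ∣-refl : ∀ {D X} → X ≃ D → D ∣ X
  ∣-refl {D} X≃D = 𝟏 , ≃-trans X≃D (solve 1 (λ d → d := d :* con 1ℤ) ≃-refl D)

  ∣-𝟎 : ∀ {D} → D ∣ 𝟎
  ∣-𝟎 {D} = 𝟎 , solve 1 (λ d → con 0ℤ := d :* con 0ℤ) ≃-refl D

  ∣-⊟ : ∀ {D X Y} → D ∣ X → D ∣ Y → D ∣ X ⊟ Y
  ∣-⊟ {D} (R , X≃DR) (R′ , Y≃DR′) =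
    R ⊟ R′ , ≃-trans (+-cong X≃DR (-‿cong Y≃DR′)) (solve 3 (λ d r r′ → d :* r :- d :* r′ := d :* (r :- r′)) ≃-refl D R R′)

  ∣-⊠ : ∀ c {D X} → D ∣ X → D ∣ c ⊠ X
  ∣-⊠ c {D} (R , X≃DR) =
    c ⊠ R , ≃-trans (*-cong ≃-refl X≃DR) (solve 3 (λ c d r → c :* (d :* r) := d :* (c :* r)) ≃-refl c D R)

  ∣-transfer : ∀ {c D D′ e X} → c ⊠ D ≃ D′ ⊠ e → D ∣ X → D′ ∣ c ⊠ X
  ∣-transfer {c} {D} {D′} {e} {X} cD≃D′e (R , X≃DR) = e ⊠ R , (begin
    c ⊠ X            ≈⟨ *-cong ≃-refl X≃DR ⟩
    c ⊠ (D ⊠ R)      ≈⟨ solve 3 (λ c d r → c :* (d :* r) := c :* d :* r) ≃-refl c D R ⟩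
    c ⊠ D ⊠ R        ≈⟨ *-cong cD≃D′e ≃-refl ⟩
    D′ ⊠ e ⊠ R       ≈⟨ solve 3 (λ d e r → d :* e :* r := d :* (e :* r)) ≃-refl D′ e R ⟩
    D′ ⊠ (e ⊠ R)     ∎)

  partial-divisible : ∀ s m a → M (m ℕ.+ a) a ∣ partial (m ℕ.+ a) s a m
  partial-divisible zero m a = ∣-refl (partial-at-zero m a)
  partial-divisible (suc s) m a =
    ∣-resp (≃-sym (partial-suc n s a m))
      (∣-⊠ (qpow (+ s ℤ.- + n)) (∣-⊟ (weighted-divisible m) (∣-⊠ (A n s) (partial-divisible s m a))))
    where
    n = m ℕ.+ a
    weighted-divisible : ∀ m → M (m ℕ.+ a) a ∣ weighted (m ℕ.+ a) s a m
    weighted-divisible zero = ∣-resp (≃-sym (weighted-top s a)) ∣-𝟎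
    weighted-divisible (suc m′) =
      ∣-resp (≃-sym (weighted-shift s m′ a)) (∣-transfer (modulus-shift m′ a) (partial-divisible s m′ a))

open import Data.Nat using (_∸_)
open import Data.Nat.Properties using (m∸n+n≡m)
open import Data.Product using (_,_; proj₁; proj₂)
open import Relation.Binary.PropositionalEquality using (subst)

-- Lemma 5.1.
lemma5p1 : (n a s : ℕ) → 1 ≤ n → a ≤ n → modulus n a ∣L lhs n a s
lemma5p1 n a s _ a≤n = quotient , get (begin
  lhs n a s                  ≈⟨ ≡⇒≃ (lhs≡partial n a s) ⟩
  partial n s a (n ∸ a)      ≈⟨ proj₂ M∣partial ⟩
  M n a ⊠ quotient           ≈⟨ *-cong (≃-sym (modulus≃M n a)) ≃-refl ⟩
  modulus n a ⊠ quotient     ≈⟨ ≃-sym (*L≃⊠ (modulus n a) quotient) ⟩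
  modulus n a *L quotient    ∎)
  where
  open LaurentRing
  open Summand using (M; modulus≃M)
  open Induction using (_∣_; partial; lhs≡partial; partial-divisible)
  M∣partial : M n a ∣ partial n s a (n ∸ a)
  M∣partial = subst (λ N → M N a ∣ partial N s a (n ∸ a)) (m∸n+n≡m a≤n) (partial-divisible s (n ∸ a) a)
  quotient : Laurent
  quotient = proj₁ M∣partial
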